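{- Let $\mathcal{T}$ be an admissible rooted tree with the random marking scheme described in the context, and let $\ell$ be a non-root Steiner node. Let $\ell_q$ be the lowest proper ancestor of $\ell$ with $t(\ell_q)>0$, let $\ell=\ell_1,\ell_2,\ldots,\ell_q$ ($q\ge 2$) be the simple path from $\ell$ to $\ell_q$, and let $d_i=d(\ell_i)$. Then $$c(\ell)=\sum_{h=1}^{q-2}\frac{(d_{h+1}-1)\,H_{d_1+\cdots+d_h-h+1}}{d_2\cdot\ldots\cdot d_{h+1}}+\frac{H_{d_1+\cdots+d_{q-1}-q+2}}{d_2\cdot\ldots\cdot d_{q-1}},$$ where an empty product equals $1$.
   Context: $H_i=1+\frac12+\cdots+\frac1i$ is the $i$-th harmonic number ($H_0=0$). An admissible rooted tree is a finite rooted tree whose nodes are partitioned into terminals and Steiner nodes, such that every leaf is a terminal and every terminal is a leaf, each Steiner node has at most $2$ terminal children, and the root is a Steiner node with at least one terminal child. For a Steiner node $\ell$, $d(\ell)$, $s(\ell)$, $t(\ell)$ denote its number of children, Steiner children, and terminal children. Marking scheme: independently for each Steiner node $\ell$, if $t(\ell)>0$ choose one terminal child $u$ uniformly at random and mark the edge $\{\ell,u\}$; otherwise choose one (Steiner) child $\ell'$ uniformly at random and mark $\{\ell,\ell'\}$. All other edges are unmarked. Let $m(\ell)$ be the marked child edge of $\ell$. For an edge $e$, the witness set $W(e)$ is the set of unordered pairs $\{t',t''\}$ of terminals such that the simple $t'$-$t''$ path in the tree contains $e$ and exactly one unmarked edge; $w(e)=|W(e)|$. The cost of a Steiner node is $c(\ell)=E[H_{w(m(\ell))}]$.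 -}

module Defs where

open import Data.Bool using (Bool; true; false; _∧_; _∨_; not; if_then_else_)
open import Data.Nat using (ℕ; zero; suc; _+_; _*_; _∸_; _≤_; _<_; _≡ᵇ_)
open import Data.Integer using () renaming (+_ to ℤ+)
open import Data.Rational using (ℚ; 0ℚ; 1ℚ; _/_) renaming (_+_ to _+ℚ_; _*_ to _*ℚ_)
open import Data.List using (List; []; _∷_; _++_; map; concatMap; filter; length; take; upTo; foldr; [_])
open import Data.Nat.ListAction using (sum)
open import Data.Maybe using (Maybe; just; nothing)
open import Data.Product using (_×_; _,_; Σ; ∃)
open import Data.List.Relation.Unary.All using (All)
open import Relation.Nullary.Decidable using (does)
open import Relation.Binary.PropositionalEquality using (_≡_)
open import Relation.Unary using (Pred)
import Data.Bool as B

-- reciprocal of a natural number; the value at 0 is an irrelevant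
-- convention (only ever applied to positive numbers below)
recip : ℕ → ℚ
recip zero    = 0ℚ
recip (suc n) = ℤ+ 1 / suc n

ℕ→ℚ : ℕ → ℚ
ℕ→ℚ n = ℤ+ n / 1

H : ℕ → ℚ
H zero    = 0ℚ
H (suc n) = H n +ℚ recip (suc n)

-- the list [a, a+1, ..., b]  (empty if b < a)
range : ℕ → ℕ → List ℕ
range a b = map (λ k → a + k) (upTo (suc b ∸ a))

Σℚ : ℕ → ℕ → (ℕ → ℚ) → ℚ
Σℚ a b f = foldr _+ℚ_ 0ℚ (map f (range a b))

Σℕ : ℕ → ℕ → (ℕ → ℕ) → ℕ
Σℕ a b f = sum (map f (range a b))

Πℕ : ℕ → ℕ → (ℕ → ℕ) → ℕ
Πℕ a b f = foldr _*_ 1 (map f (range a b))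

data Tree : Set where
  term  : Tree
  stein : List Tree → Tree

isTerm : Tree → Bool
isTerm term      = true
isTerm (stein _) = false

tcount : List Tree → ℕ
tcount ts = length (filter (λ t → isTerm t B.≟ true) ts)

-- every Steiner node has at least one child (so every leaf is a terminal;
-- terminals are leaves by construction) and at most 2 terminal children
data WF : Tree → Set where
  wf-term  : WF term
  wf-stein : ∀ {ts} → 1 ≤ length ts → tcount ts ≤ 2 → All WF ts → WF (stein ts)

Admissible : Tree → Set
Admissible term       = Data.Empty.⊥ where import Data.Empty
Admissible (stein ts) = WF (stein ts) × (1 ≤ tcount ts)

-- Positions: a node is addressed by the list of child indices from the root.
-- The edge between a node at position p and its parent is identified
-- with the (nonempty) position p.

lookupL : {A : Set} → List A → ℕ → Maybe A
lookupL []       _       = nothing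
lookupL (x ∷ xs) zero    = just x
lookupL (x ∷ xs) (suc i) = lookupL xs i

subtree : Tree → List ℕ → Maybe Tree
subtree t [] = just t
subtree term (i ∷ p) = nothing
subtree (stein ts) (i ∷ p) with lookupL ts i
... | nothing = nothing
... | just t  = subtree t p

-- d(ℓ) and t(ℓ) of the node at a position (0 if not a Steiner node)
dAt : Tree → List ℕ → ℕ
dAt T p with subtree T p
... | just (stein ts) = length ts
... | _ = 0

tAt : Tree → List ℕ → ℕ
tAt T p with subtree T p
... | just (stein ts) = tcount ts
... | _ = 0

IsSteinerAt : Tree → List ℕ → Set
IsSteinerAt T p = ∃ λ ts → subtree T p ≡ just (stein ts)

-- the i-th node (i ≥ 1) on the path from the node at p towards the root:
-- ℓ_1 = p, ℓ_2 = parent, ...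
anc : List ℕ → ℕ → List ℕ
anc p i = take (length p ∸ (i ∸ 1)) p

mutual
  terms : Tree → List (List ℕ)
  terms term       = [ [] ]
  terms (stein ts) = termsL 0 ts

  termsL : ℕ → List Tree → List (List ℕ)
  termsL k []       = []
  termsL k (t ∷ ts) = map (k ∷_) (terms t) ++ termsL (suc k) ts

pairs : {A : Set} → List A → List (A × A)
pairs []       = []
pairs (x ∷ xs) = map (x ,_) xs ++ pairs xs

eqL : List ℕ → List ℕ → Bool
eqL []       []       = true
eqL (x ∷ xs) (y ∷ ys) = (x ≡ᵇ y) ∧ eqL xs ys
eqL _        _        = false

prefixᵇ : List ℕ → List ℕ → Bool
prefixᵇ []       _        = true
prefixᵇ (x ∷ xs) []       = false
prefixᵇ (x ∷ xs) (y ∷ ys) = (x ≡ᵇ y) ∧ prefixᵇ xs ys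

memL : List ℕ → List (List ℕ) → Bool
memL e []       = false
memL e (x ∷ xs) = eqL e x ∨ memL e xs

-- nonempty prefixes of a position = edges on the path from the root to it
edgesToRoot : List ℕ → List (List ℕ)
edgesToRoot a = map (λ k → take k a) (range 1 (length a))

pathEdges : List ℕ → List ℕ → List (List ℕ)
pathEdges a b =
  filter (λ e → not (prefixᵇ e b) B.≟ true) (edgesToRoot a) ++
  filter (λ e → not (prefixᵇ e a) B.≟ true) (edgesToRoot b)

-- Markings: for each Steiner node the index of its marked child

data Mk : Set where
  mk : ℕ → List Mk → Mk

choiceAt : Mk → List ℕ → ℕ
choiceAt (mk c ms) []      = c
choiceAt (mk c ms) (i ∷ p) with lookupL ms i
... | nothing = 0
... | just m  = choiceAt m p

markedGo : Mk → ℕ → List ℕ → Bool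
markedGo (mk c ms) i []      = c ≡ᵇ i
markedGo (mk c ms) i (j ∷ p) = sub (lookupL ms i)
  where
  sub : Maybe Mk → Bool
  sub nothing  = false
  sub (just m) = markedGo m j p

markedE : Mk → List ℕ → Bool
markedE m []      = false
markedE m (i ∷ p) = markedGo m i p

-- indices of the children among which the marked child is chosen:
-- the terminal children if there is one, otherwise all children
termIdx : ℕ → List Tree → List ℕ
termIdx k []       = []
termIdx k (t ∷ ts) = (if isTerm t then k ∷ [] else []) ++ termIdx (suc k) ts

allowed : List Tree → List ℕ
allowed ts with termIdx 0 ts
... | []      = range 0 (length ts ∸ 1)
... | (x ∷ xs) = x ∷ xs

-- the probability distribution of the random marking scheme, as a list of
-- (probability, outcome): independent uniform choices at each Steiner node
mutual
  markDist : Tree → List (ℚ × Mk)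
  markDist term       = [ (1ℚ , mk 0 []) ]
  markDist (stein ts) =
    concatMap (λ i → map (λ { (pr , ms) → (recip (length (allowed ts)) *ℚ pr , mk i ms) })
                         (markDistL ts))
              (allowed ts)

  markDistL : List Tree → List (ℚ × List Mk)
  markDistL []       = [ (1ℚ , []) ]
  markDistL (t ∷ ts) =
    concatMap (λ { (p₁ , m) → map (λ { (p₂ , ms) → (p₁ *ℚ p₂ , m ∷ ms) }) (markDistL ts) })
              (markDist t)

E : Tree → (Mk → ℚ) → ℚ
E T f = foldr _+ℚ_ 0ℚ (map (λ { (pr , m) → pr *ℚ f m }) (markDist T))

unmarkedOn : Mk → List ℕ → List ℕ → ℕ
unmarkedOn m a b = length (filter (λ e → not (markedE m e) B.≟ true) (pathEdges a b))

w : Tree → Mk → List ℕ → ℕ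
w T m e = length (filter (λ { (a , b) → (memL e (pathEdges a b) ∧ (unmarkedOn m a b ≡ᵇ 1)) B.≟ true })
                         (pairs (terms T)))

-- c(ℓ) = E[H_{w(m(ℓ))}] for the Steiner node ℓ at position p;
-- m(ℓ) is the edge to the child p ++ [choice at p]
cost : Tree → List ℕ → ℚ
cost T p = E T (λ m → H (w T m (p ++ [ choiceAt m p ])))

formula : (ℕ → ℕ) → ℕ → ℚ
formula d q =
  Σℚ 1 (q ∸ 2) (λ h →
      ℕ→ℚ (d (suc h) ∸ 1) *ℚ H (Σℕ 1 h d + 1 ∸ h) *ℚ recip (Πℕ 2 (suc h) d))
  +ℚ H (Σℕ 1 (q ∸ 1) d + 2 ∸ q) *ℚ recip (Πℕ 2 (q ∸ 1) d)

-- For an observable G : ℕ → ℕ → ℚ, expectAt s p G is the expectation of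
-- G(w(m(ℓ)), z), where ℓ is the node at position p and z ∈ {0, 1} counts the
-- terminals reached from the root through m(ℓ) by marked edges only.
--  * Counting (w-child, reachThrough-child): below the root's child x, w and z
--    are determined by their values in the subtree of x, the root's choice c
--    and its degree n.
--  * Probability (expectAt-child, expectAt-root): the root's uniform choice is
--    independent of the children's markings, so expectAt at x ∷ p is the average
--    over c of expectAt in the subtree for the observable viaChoice G n x c.
--  * Arithmetic (Φ-step, Φ-to-Ω): along a path without terminal children this
--    gives the closed form Φ; at ℓ_q a terminal child is marked, turning Φ into
--    the right-hand side Ω.

module Submission where

open import Defs
open import Data.Bool using (Bool; true; false; _∧_; _∨_; not; if_then_else_)
import Data.Bool as B
open import Data.Bool.Properties using (∨-comm; ∨-assoc; ∨-identityʳ)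
open import Data.Nat using (ℕ; zero; suc; _+_; _*_; _∸_; _≤_; _<_; _≡ᵇ_; _≟_; _≤?_; z≤n; s≤s)
import Data.Nat.Properties as ℕₚ
open import Data.Nat.Solver using (module +-*-Solver)
open import Data.Nat.ListAction using (sum)
import Data.Nat.ListAction.Properties as ListActionₚ
open import Data.List using (List; []; _∷_; _++_; map; concatMap; filter; length; take; upTo; applyUpTo; foldr; [_])
import Data.List.Properties as Listₚ
open import Data.List.Relation.Unary.All using (All; []; _∷_; universal) renaming (map to All-map)
open import Data.List.Relation.Unary.All.Properties using (++⁺; map⁺; gmap⁺; filter⁺; applyUpTo⁺₁; concat⁺)
open import Data.Product using (_×_; _,_; Σ; proj₁; proj₂)
open import Data.Sum using (_⊎_; inj₁; inj₂)
open import Data.Integer using () renaming (+_ to ℤ+; _*_ to _*ℤ_; _+_ to _+ℤ_)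
import Data.Integer.Properties as ℤₚ
open import Data.Rational using (ℚ; 0ℚ; 1ℚ) renaming (_+_ to _+ℚ_; _*_ to _*ℚ_)
open import Data.Rational.Base using (fromℚᵘ)
import Data.Rational.Properties as ℚₚ
open import Data.Rational.Solver using () renaming (module +-*-Solver to ℚ-Solver)
open import Data.Rational.Unnormalised using (mkℚᵘ; *≡*) renaming (_+_ to _+ᵘ_; _*_ to _*ᵘ_)
import Data.Rational.Unnormalised.Properties as ℚᵘₚ
open import Data.Unit using (⊤; tt)
open import Data.Maybe using (Maybe; just; nothing)
open import Data.Empty using (⊥; ⊥-elim)
open import Relation.Nullary using (yes; no)
open import Relation.Binary.Definitions using (Tri; tri<; tri≈; tri>)
open import Relation.Nullary.Decidable using (dec-true; dec-false)
open import Relation.Binary.PropositionalEquality using (_≡_; _≢_; refl; sym; trans; cong; cong₂; subst)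
open Relation.Binary.PropositionalEquality.≡-Reasoning

𝟙 : Bool → ℕ
𝟙 true  = 1
𝟙 false = 0

count : {A : Set} → (A → Bool) → List A → ℕ
count f []       = 0
count f (x ∷ xs) = 𝟙 (f x) + count f xs

length-filter : {A : Set} (f : A → Bool) (xs : List A) →
  length (filter (λ x → f x B.≟ true) xs) ≡ count f xs
length-filter f [] = refl
length-filter f (x ∷ xs) with f x
... | true  = cong suc (length-filter f xs)
... | false = length-filter f xs

count-++ : {A : Set} (f : A → Bool) (xs ys : List A) → count f (xs ++ ys) ≡ count f xs + count f ys
count-++ f []       ys = refl
count-++ f (x ∷ xs) ys = trans (cong (𝟙 (f x) +_) (count-++ f xs ys)) (sym (ℕₚ.+-assoc (𝟙 (f x)) _ _))

count-map : {A C : Set} (f : C → Bool) (g : A → C) (xs : List A) → count f (map g xs) ≡ count (λ x → f (g x)) xs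
count-map f g []       = refl
count-map f g (x ∷ xs) = cong (𝟙 (f (g x)) +_) (count-map f g xs)

count-cong : {A : Set} {f g : A → Bool} (xs : List A) → All (λ x → f x ≡ g x) xs → count f xs ≡ count g xs
count-cong []       []       = refl
count-cong (x ∷ xs) (e ∷ es) = cong₂ (λ a b → 𝟙 a + b) e (count-cong xs es)

count-none : {A : Set} {f : A → Bool} (xs : List A) → All (λ x → f x ≡ false) xs → count f xs ≡ 0
count-none []       []       = refl
count-none (x ∷ xs) (e ∷ es) rewrite e = count-none xs es

count-∧ : {A : Set} (β : Bool) (f : A → Bool) (xs : List A) → count (λ a → β ∧ f a) xs ≡ 𝟙 β * count f xs
count-∧ true  f xs = sym (ℕₚ.+-identityʳ _)
count-∧ false f xs = count-none xs (universal (λ _ → refl) xs)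

𝟙-∧ : ∀ a b → 𝟙 (a ∧ b) ≡ 𝟙 a * 𝟙 b
𝟙-∧ true  b = sym (ℕₚ.+-identityʳ _)
𝟙-∧ false b = refl

sumOver : {A : Set} → (A → ℕ) → List A → ℕ
sumOver f []       = 0
sumOver f (x ∷ xs) = f x + sumOver f xs

sumOver-cong : {A : Set} {f g : A → ℕ} (xs : List A) → All (λ x → f x ≡ g x) xs → sumOver f xs ≡ sumOver g xs
sumOver-cong []       []       = refl
sumOver-cong (x ∷ xs) (e ∷ es) = cong₂ _+_ e (sumOver-cong xs es)

sumOver-+ : {A : Set} (f g : A → ℕ) (xs : List A) → sumOver (λ x → f x + g x) xs ≡ sumOver f xs + sumOver g xs
sumOver-+ f g []       = refl
sumOver-+ f g (x ∷ xs) rewrite sumOver-+ f g xs = interchange (f x) (g x) (sumOver f xs) (sumOver g xs)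
  where
  open +-*-Solver
  interchange : ∀ a b c d → a + b + (c + d) ≡ a + c + (b + d)
  interchange = solve 4 (λ a b c d → a :+ b :+ (c :+ d) := a :+ c :+ (b :+ d)) refl

sumOver-zero : {A : Set} (xs : List A) → sumOver (λ _ → 0) xs ≡ 0
sumOver-zero []       = refl
sumOver-zero (x ∷ xs) = sumOver-zero xs

sumOver-swap : {A C : Set} (f : A → C → ℕ) (xs : List A) (ys : List C) →
  sumOver (λ x → sumOver (f x) ys) xs ≡ sumOver (λ y → sumOver (λ x → f x y) xs) ys
sumOver-swap f []       ys = sym (sumOver-zero ys)
sumOver-swap f (x ∷ xs) ys = trans (cong (sumOver (f x) ys +_) (sumOver-swap f xs ys))
  (sym (sumOver-+ (f x) (λ y → sumOver (λ x′ → f x′ y) xs) ys))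

sumOver-map : {A C : Set} (f : C → ℕ) (g : A → C) (xs : List A) → sumOver f (map g xs) ≡ sumOver (λ x → f (g x)) xs
sumOver-map f g []       = refl
sumOver-map f g (x ∷ xs) = cong (f (g x) +_) (sumOver-map f g xs)

sumOver-*ʳ : {A : Set} (f : A → ℕ) (K : ℕ) (xs : List A) → sumOver (λ a → f a * K) xs ≡ sumOver f xs * K
sumOver-*ʳ f K []       = refl
sumOver-*ʳ f K (x ∷ xs) = trans (cong (f x * K +_) (sumOver-*ʳ f K xs)) (sym (ℕₚ.*-distribʳ-+ K (f x) (sumOver f xs)))

count-as-sum : {A : Set} (f : A → Bool) (xs : List A) → count f xs ≡ sumOver (λ x → 𝟙 (f x)) xs
count-as-sum f []       = refl
count-as-sum f (x ∷ xs) = cong (𝟙 (f x) +_) (count-as-sum f xs)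

countPairs : {A : Set} → (A → A → Bool) → List A → ℕ
countPairs P xs = count (λ q → P (proj₁ q) (proj₂ q)) (pairs xs)

crossPairs : {A : Set} → (A → A → Bool) → List A → List A → ℕ
crossPairs P xs ys = sumOver (λ x → count (P x) ys) xs

count-pairs-head : {A : Set} (P : A → A → Bool) (x : A) (ys : List A) →
  count (λ q → P (proj₁ q) (proj₂ q)) (map (x ,_) ys) ≡ count (P x) ys
count-pairs-head P x []       = refl
count-pairs-head P x (y ∷ ys) = cong (𝟙 (P x y) +_) (count-pairs-head P x ys)

countPairs-++ : {A : Set} (P : A → A → Bool) (xs ys : List A) →
  countPairs P (xs ++ ys) ≡ countPairs P xs + countPairs P ys + crossPairs P xs ys
countPairs-++ P []       ys = sym (ℕₚ.+-identityʳ _)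
countPairs-++ P (x ∷ xs) ys = begin
    count Q (map (x ,_) (xs ++ ys) ++ pairs (xs ++ ys))
  ≡⟨ count-++ Q (map (x ,_) (xs ++ ys)) (pairs (xs ++ ys)) ⟩
    count Q (map (x ,_) (xs ++ ys)) + countPairs P (xs ++ ys)
  ≡⟨ cong₂ _+_ (trans (count-pairs-head P x (xs ++ ys)) (count-++ (P x) xs ys)) (countPairs-++ P xs ys) ⟩
    (count (P x) xs + count (P x) ys) + (countPairs P xs + countPairs P ys + crossPairs P xs ys)
  ≡⟨ regroup (count (P x) xs) (count (P x) ys) (countPairs P xs) (countPairs P ys) (crossPairs P xs ys) ⟩
    (count (P x) xs + countPairs P xs) + countPairs P ys + (count (P x) ys + crossPairs P xs ys)
  ≡⟨ cong (λ z → z + countPairs P ys + (count (P x) ys + crossPairs P xs ys))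
       (sym (trans (count-++ Q (map (x ,_) xs) (pairs xs)) (cong (_+ countPairs P xs) (count-pairs-head P x xs)))) ⟩
    count Q (map (x ,_) xs ++ pairs xs) + countPairs P ys + (count (P x) ys + crossPairs P xs ys)
  ∎
  where
  Q = λ q → P (proj₁ q) (proj₂ q)
  open +-*-Solver
  regroup : ∀ a b c d e → (a + b) + (c + d + e) ≡ (a + c) + d + (b + e)
  regroup = solve 5 (λ a b c d e → (a :+ b) :+ (c :+ d :+ e) := (a :+ c) :+ d :+ (b :+ e)) refl

module _ {A : Set} (P : A → A → Bool) (O : A → Set)
         (P-sym : ∀ a b → P a b ≡ P b a) (P-outer : ∀ a b → O a → O b → P a b ≡ false) where

  private
    none-with : ∀ {x} → O x → ∀ ys → All O ys → All (λ y → P x y ≡ false) ys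
    none-with ox []       []          = []
    none-with ox (y ∷ ys) (oy ∷ oys) = P-outer _ y ox oy ∷ none-with ox ys oys

    countPairs-outer : ∀ xs → All O xs → countPairs P xs ≡ 0
    countPairs-outer []       []       = refl
    countPairs-outer (x ∷ xs) (o ∷ os) = trans (count-++ _ (map (x ,_) xs) (pairs xs))
      (cong₂ _+_ (trans (count-pairs-head P x xs) (count-none xs (none-with o xs os))) (countPairs-outer xs os))

    crossPairs-outer : ∀ xs ys → All O xs → All O ys → crossPairs P xs ys ≡ 0
    crossPairs-outer []       ys []       oy = refl
    crossPairs-outer (x ∷ xs) ys (o ∷ os) oy = cong₂ _+_ (count-none ys (none-with o ys oy)) (crossPairs-outer xs ys os oy)

    crossPairs-flip : ∀ xs ys → crossPairs P xs ys ≡ sumOver (λ a → count (P a) xs) ys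
    crossPairs-flip xs ys = begin
        sumOver (λ b → count (P b) ys) xs
      ≡⟨ sumOver-cong xs (universal (λ b → count-as-sum (P b) ys) xs) ⟩
        sumOver (λ b → sumOver (λ a → 𝟙 (P b a)) ys) xs
      ≡⟨ sumOver-swap (λ b a → 𝟙 (P b a)) xs ys ⟩
        sumOver (λ a → sumOver (λ b → 𝟙 (P b a)) xs) ys
      ≡⟨ sumOver-cong ys (universal (λ a → trans (sumOver-cong xs (universal (λ b → cong 𝟙 (P-sym b a)) xs))
                                                 (sym (count-as-sum (P a) xs))) ys) ⟩
        sumOver (λ a → count (P a) xs) ys
      ∎

  countPairs-around : ∀ xs ys zs → All O xs → All O zs →
    countPairs P (xs ++ (ys ++ zs)) ≡ countPairs P ys + sumOver (λ a → count (P a) (xs ++ zs)) ys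
  countPairs-around xs ys zs ox oz = begin
      countPairs P (xs ++ (ys ++ zs))
    ≡⟨ countPairs-++ P xs (ys ++ zs) ⟩
      countPairs P xs + countPairs P (ys ++ zs) + crossPairs P xs (ys ++ zs)
    ≡⟨ cong₂ (λ u v → u + v + crossPairs P xs (ys ++ zs)) (countPairs-outer xs ox) (countPairs-++ P ys zs) ⟩
      countPairs P ys + countPairs P zs + crossPairs P ys zs + crossPairs P xs (ys ++ zs)
    ≡⟨ cong₂ (λ u v → countPairs P ys + u + crossPairs P ys zs + v) (countPairs-outer zs oz) fromXs ⟩
      countPairs P ys + 0 + SZ + SX
    ≡⟨ cong (λ u → u + SZ + SX) (ℕₚ.+-identityʳ (countPairs P ys)) ⟩
      countPairs P ys + SZ + SX
    ≡⟨ ℕₚ.+-assoc (countPairs P ys) SZ SX ⟩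
      countPairs P ys + (SZ + SX)
    ≡⟨ cong (countPairs P ys +_) (trans (ℕₚ.+-comm SZ SX) (sym (sumOver-+ (λ a → count (P a) xs) (λ a → count (P a) zs) ys))) ⟩
      countPairs P ys + sumOver (λ a → count (P a) xs + count (P a) zs) ys
    ≡⟨ cong (countPairs P ys +_) (sumOver-cong ys (universal (λ a → sym (count-++ (P a) xs zs)) ys)) ⟩
      countPairs P ys + sumOver (λ a → count (P a) (xs ++ zs)) ys
    ∎
    where
    SZ = sumOver (λ a → count (P a) zs) ys
    SX = sumOver (λ a → count (P a) xs) ys
    fromXs : crossPairs P xs (ys ++ zs) ≡ SX
    fromXs = begin
        sumOver (λ b → count (P b) (ys ++ zs)) xs
      ≡⟨ sumOver-cong xs (universal (λ b → count-++ (P b) ys zs) xs) ⟩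
        sumOver (λ b → count (P b) ys + count (P b) zs) xs
      ≡⟨ sumOver-+ (λ b → count (P b) ys) (λ b → count (P b) zs) xs ⟩
        crossPairs P xs ys + crossPairs P xs zs
      ≡⟨ cong₂ _+_ (crossPairs-flip xs ys) (crossPairs-outer xs zs ox oz) ⟩
        SX + 0
      ≡⟨ ℕₚ.+-identityʳ SX ⟩
        SX
      ∎

pairs-map : {A : Set} (f : A → A) (xs : List A) →
  pairs (map f xs) ≡ map (λ q → (f (proj₁ q) , f (proj₂ q))) (pairs xs)
pairs-map f []       = refl
pairs-map f (x ∷ xs) rewrite pairs-map f xs | Listₚ.map-++ (λ q → (f (proj₁ q) , f (proj₂ q))) (map (x ,_) xs) (pairs xs) =
  cong (_++ _) (trans (sym (Listₚ.map-∘ xs)) (Listₚ.map-∘ xs))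

-- The edges on the path from the root to position a are
-- the nonempty prefixes of a; the path between a and b consists of the root
-- paths of a and b minus their common part.

prefixes : List ℕ → List (List ℕ)
prefixes []      = []
prefixes (x ∷ a) = map (x ∷_) ([] ∷ prefixes a)

edgesToRoot≡prefixes : ∀ a → edgesToRoot a ≡ prefixes a
edgesToRoot≡prefixes a = trans (sym (Listₚ.map-∘ (upTo (length a)))) (shifted a)
  where
  shifted : ∀ a → map (λ k → take (suc k) a) (upTo (length a)) ≡ prefixes a
  shifted []      = refl
  shifted (x ∷ a) = cong ([ x ] ∷_) (begin
      map (λ k → take (suc k) (x ∷ a)) (applyUpTo suc (length a))
    ≡⟨ Listₚ.map-applyUpTo suc (λ k → take (suc k) (x ∷ a)) (length a) ⟩
      applyUpTo (λ k → x ∷ take (suc k) a) (length a)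
    ≡⟨ sym (trans (sym (Listₚ.map-∘ (upTo (length a)))) (Listₚ.map-applyUpTo (λ k → k) (λ k → x ∷ take (suc k) a) (length a))) ⟩
      map (x ∷_) (map (λ k → take (suc k) a) (upTo (length a)))
    ≡⟨ cong (map (x ∷_)) (shifted a) ⟩
      map (x ∷_) (prefixes a)
    ∎)

pathEdges≡ : ∀ a b → pathEdges a b ≡
  filter (λ e → not (prefixᵇ e b) B.≟ true) (prefixes a) ++ filter (λ e → not (prefixᵇ e a) B.≟ true) (prefixes b)
pathEdges≡ a b rewrite edgesToRoot≡prefixes a | edgesToRoot≡prefixes b = refl

NonEmpty : List ℕ → Set
NonEmpty []      = ⊥
NonEmpty (_ ∷ _) = ⊤

prefixes-nonEmpty : ∀ a → All NonEmpty (prefixes a)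
prefixes-nonEmpty []      = []
prefixes-nonEmpty (x ∷ a) = map⁺ (universal (λ _ → tt) ([] ∷ prefixes a))

pathEdges-nonEmpty : ∀ a b → All NonEmpty (pathEdges a b)
pathEdges-nonEmpty a b rewrite pathEdges≡ a b =
  ++⁺ (filter⁺ _ (prefixes-nonEmpty a)) (filter⁺ _ (prefixes-nonEmpty b))

≡ᵇ-refl : ∀ x → (x ≡ᵇ x) ≡ true
≡ᵇ-refl x = dec-true (x ≟ x) refl

≢⇒≡ᵇ : ∀ {x y} → x ≢ y → (x ≡ᵇ y) ≡ false
≢⇒≡ᵇ {x} {y} = dec-false (x ≟ y)

OffBranch : ℕ → List ℕ → Set
OffBranch x []      = ⊤
OffBranch x (j ∷ _) = j ≢ x

memL-++ : ∀ e (X Y : List (List ℕ)) → memL e (X ++ Y) ≡ memL e X ∨ memL e Y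
memL-++ e []      Y = refl
memL-++ e (y ∷ X) Y rewrite memL-++ e X Y = sym (∨-assoc (eqL e y) (memL e X) (memL e Y))

memL-map-cons : ∀ x e (L : List (List ℕ)) → memL (x ∷ e) (map (x ∷_) L) ≡ memL e L
memL-map-cons x e []      = refl
memL-map-cons x e (y ∷ L) rewrite ≡ᵇ-refl x = cong (eqL e y ∨_) (memL-map-cons x e L)

memL-map-other : ∀ x e j (L : List (List ℕ)) → j ≢ x → memL (x ∷ e) (map (j ∷_) L) ≡ false
memL-map-other x e j []      j≢x = refl
memL-map-other x e j (y ∷ L) j≢x rewrite ≢⇒≡ᵇ (λ x≡j → j≢x (sym x≡j)) = memL-map-other x e j L j≢x

-- the empty position (the root) is never an edge of a path
memL-nil : ∀ (L : List (List ℕ)) → All NonEmpty L → memL [] L ≡ false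
memL-nil []            []       = refl
memL-nil ((_ ∷ _) ∷ L) (_ ∷ ne) = memL-nil L ne

memL-prefixes-off : ∀ x e b → OffBranch x b → memL (x ∷ e) (prefixes b) ≡ false
memL-prefixes-off x e []      _   = refl
memL-prefixes-off x e (j ∷ b) j≢x = memL-map-other x e j ([] ∷ prefixes b) j≢x

memL-filter : ∀ e (f : List ℕ → Bool) (L : List (List ℕ)) → memL e L ≡ false →
  memL e (filter (λ y → f y B.≟ true) L) ≡ false
memL-filter e f []      h = refl
memL-filter e f (y ∷ L) h with f y
... | false = memL-filter e f L (right-false (eqL e y) h)
  where
  right-false : ∀ a {b} → a ∨ b ≡ false → b ≡ false
  right-false false h = h
... | true  = both-false (eqL e y) h
  where
  both-false : ∀ a → a ∨ memL e L ≡ false → a ∨ memL e (filter (λ y → f y B.≟ true) L) ≡ false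
  both-false false h = memL-filter e f L h

filter-same-branch : ∀ x b (L : List (List ℕ)) →
  filter (λ e → not (prefixᵇ e (x ∷ b)) B.≟ true) (map (x ∷_) L) ≡
  map (x ∷_) (filter (λ e → not (prefixᵇ e b) B.≟ true) L)
filter-same-branch x b []      = refl
filter-same-branch x b (y ∷ L) rewrite ≡ᵇ-refl x with prefixᵇ y b
... | true  = filter-same-branch x b L
... | false = cong ((x ∷ y) ∷_) (filter-same-branch x b L)

filter-off-branch : ∀ x b (L : List (List ℕ)) → OffBranch x b →
  filter (λ e → not (prefixᵇ e b) B.≟ true) (map (x ∷_) L) ≡ map (x ∷_) L
filter-off-branch x b       []      off = refl
filter-off-branch x []      (y ∷ L) off = cong ((x ∷ y) ∷_) (filter-off-branch x [] L off)
filter-off-branch x (j ∷ b) (y ∷ L) j≢x rewrite ≢⇒≡ᵇ (λ x≡j → j≢x (sym x≡j)) =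
  cong ((x ∷ y) ∷_) (filter-off-branch x (j ∷ b) L j≢x)

pathEdges-same : ∀ x a b → pathEdges (x ∷ a) (x ∷ b) ≡ map (x ∷_) (pathEdges a b)
pathEdges-same x a b rewrite pathEdges≡ (x ∷ a) (x ∷ b) | pathEdges≡ a b | ≡ᵇ-refl x
  | filter-same-branch x b (prefixes a) | filter-same-branch x a (prefixes b) =
  sym (Listₚ.map-++ (x ∷_) (filter (λ e → not (prefixᵇ e b) B.≟ true) (prefixes a))
                           (filter (λ e → not (prefixᵇ e a) B.≟ true) (prefixes b)))

pathEdges-off : ∀ x a b → OffBranch x b → pathEdges (x ∷ a) b ≡ prefixes (x ∷ a) ++ prefixes b
pathEdges-off x a b off rewrite pathEdges≡ (x ∷ a) b =
  cong₂ _++_ (filter-off-branch x b ([] ∷ prefixes a) off) (second b off)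
  where
  second : ∀ b → OffBranch x b → filter (λ e → not (prefixᵇ e (x ∷ a)) B.≟ true) (prefixes b) ≡ prefixes b
  second []      _   = refl
  second (j ∷ b) j≢x = filter-off-branch j (x ∷ a) ([] ∷ prefixes b) (λ x≡j → j≢x (sym x≡j))

witnesses : Mk → List ℕ → List ℕ → List ℕ → Bool
witnesses m e a b = memL e (pathEdges a b) ∧ (unmarkedOn m a b ≡ᵇ 1)

w≡countPairs : ∀ T m e → w T m e ≡ countPairs (witnesses m e) (terms T)
w≡countPairs T m e = length-filter _ (pairs (terms T))

unmarkedOn≡count : ∀ m a b → unmarkedOn m a b ≡ count (λ e → not (markedE m e)) (pathEdges a b)
unmarkedOn≡count m a b = length-filter _ (pathEdges a b)

unmarkedToRoot : Mk → List ℕ → ℕ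
unmarkedToRoot m a = count (λ e → not (markedE m e)) (prefixes a)

-- e = [] (the edge above the root of the subtree) or e is on the root path of a
onRootPath : List ℕ → List ℕ → Bool
onRootPath e a = eqL e [] ∨ memL e (prefixes a)

count-unmarked-branch : ∀ c ms x m → lookupL ms x ≡ just m → (L : List (List ℕ)) → All NonEmpty L →
  count (λ e → not (markedE (mk c ms) e)) (map (x ∷_) L) ≡ count (λ e → not (markedE m e)) L
count-unmarked-branch c ms x m lk L ne = trans (count-map _ (x ∷_) L) (count-cong L (All-map unchanged ne))
  where
  unchanged : ∀ {e} → NonEmpty e → not (markedE (mk c ms) (x ∷ e)) ≡ not (markedE m e)
  unchanged {j ∷ e} _ rewrite lk = refl

unmarkedToRoot-cons : ∀ c ms x m → lookupL ms x ≡ just m → ∀ a →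
  unmarkedToRoot (mk c ms) (x ∷ a) ≡ 𝟙 (not (c ≡ᵇ x)) + unmarkedToRoot m a
unmarkedToRoot-cons c ms x m lk a =
  cong (𝟙 (not (c ≡ᵇ x)) +_) (count-unmarked-branch c ms x m lk (prefixes a) (prefixes-nonEmpty a))

witnesses-same : ∀ c ms x m → lookupL ms x ≡ just m → ∀ e a b →
  witnesses (mk c ms) (x ∷ e) (x ∷ a) (x ∷ b) ≡ witnesses m e a b
witnesses-same c ms x m lk e a b
  rewrite unmarkedOn≡count (mk c ms) (x ∷ a) (x ∷ b) | unmarkedOn≡count m a b | pathEdges-same x a b
        | memL-map-cons x e (pathEdges a b)
        | count-unmarked-branch c ms x m lk (pathEdges a b) (pathEdges-nonEmpty a b) = refl

witnesses-off : ∀ M x e a b → OffBranch x b →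
  witnesses M (x ∷ e) (x ∷ a) b ≡ onRootPath e a ∧ (unmarkedToRoot M (x ∷ a) + unmarkedToRoot M b ≡ᵇ 1)
witnesses-off M x e a b off
  rewrite unmarkedOn≡count M (x ∷ a) b | pathEdges-off x a b off
        | memL-++ (x ∷ e) (prefixes (x ∷ a)) (prefixes b) | memL-prefixes-off x e b off
        | ∨-identityʳ (memL (x ∷ e) (prefixes (x ∷ a))) | memL-map-cons x e ([] ∷ prefixes a)
        | count-++ (λ e′ → not (markedE M e′)) (prefixes (x ∷ a)) (prefixes b) = refl

-- the witness condition only depends on the path as an unordered set of edges
witness-swap : ∀ e (f : List ℕ → Bool) (X Y : List (List ℕ)) →
  memL e (X ++ Y) ∧ (count f (X ++ Y) ≡ᵇ 1) ≡ memL e (Y ++ X) ∧ (count f (Y ++ X) ≡ᵇ 1)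
witness-swap e f X Y rewrite memL-++ e X Y | memL-++ e Y X | count-++ f X Y | count-++ f Y X =
  cong₂ (λ u v → u ∧ (v ≡ᵇ 1)) (∨-comm (memL e X) (memL e Y)) (ℕₚ.+-comm (count f X) (count f Y))

witnesses-sym : ∀ M e a b → witnesses M e a b ≡ witnesses M e b a
witnesses-sym M e a b rewrite unmarkedOn≡count M a b | unmarkedOn≡count M b a | pathEdges≡ a b | pathEdges≡ b a =
  witness-swap e (λ e′ → not (markedE M e′)) (filter (λ e′ → not (prefixᵇ e′ b) B.≟ true) (prefixes a))
                                             (filter (λ e′ → not (prefixᵇ e′ a) B.≟ true) (prefixes b))

witnesses-outer : ∀ M x e a b → OffBranch x a → OffBranch x b → witnesses M (x ∷ e) a b ≡ false
witnesses-outer M x e a b offa offb rewrite pathEdges≡ a b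
  | memL-++ (x ∷ e) (filter (λ e′ → not (prefixᵇ e′ b) B.≟ true) (prefixes a)) (filter (λ e′ → not (prefixᵇ e′ a) B.≟ true) (prefixes b))
  | memL-filter (x ∷ e) (λ e′ → not (prefixᵇ e′ b)) (prefixes a) (memL-prefixes-off x e a offa)
  | memL-filter (x ∷ e) (λ e′ → not (prefixᵇ e′ a)) (prefixes b) (memL-prefixes-off x e b offb) = refl

mutual
  data Valid : Tree → Mk → Set where
    valid-term  : ∀ {m} → Valid term m
    valid-stein : ∀ {ts c ms} → c < length ts → ValidList ts ms → Valid (stein ts) (mk c ms)

  data ValidList : List Tree → List Mk → Set where
    []  : ValidList [] []
    _∷_ : ∀ {t ts m ms} → Valid t m → ValidList ts ms → ValidList (t ∷ ts) (m ∷ ms)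

valid-index : ∀ {ts c ms} → Valid (stein ts) (mk c ms) → c < length ts
valid-index (valid-stein c<n _) = c<n

valid-children : ∀ {ts c ms} → Valid (stein ts) (mk c ms) → ValidList ts ms
valid-children (valid-stein _ vl) = vl

interval : ℕ → ℕ → List ℕ
interval k zero    = []
interval k (suc n) = k ∷ interval (suc k) n

Outside : ℕ → ℕ → ℕ → Set
Outside c k n = c < k ⊎ k + n ≤ c

outside-step : ∀ {c k n} → Outside c k (suc n) → c ≢ k × Outside c (suc k) n
outside-step (inj₁ c<k)   = ℕₚ.<⇒≢ c<k , inj₁ (ℕₚ.m≤n⇒m≤1+n c<k)
outside-step {c} {k} {n} (inj₂ k+n<c) = ℕₚ.>⇒≢ (ℕₚ.m+n≤o⇒m≤o (suc k) k+n≤c) , inj₂ k+n≤c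
  where k+n≤c = subst (_≤ c) (ℕₚ.+-suc k n) k+n<c

hits-outside : ∀ c k n → Outside c k n → count (c ≡ᵇ_) (interval k n) ≡ 0
hits-outside c k zero    out = refl
hits-outside c k (suc n) out rewrite ≢⇒≡ᵇ (proj₁ (outside-step out)) = hits-outside c (suc k) n (proj₂ (outside-step out))

hits-inside : ∀ c k n → k ≤ c → c < k + n → count (c ≡ᵇ_) (interval k n) ≡ 1
hits-inside c k zero    k≤c c<k+0 = ⊥-elim (ℕₚ.<-irrefl refl (ℕₚ.≤-<-trans k≤c (subst (c <_) (ℕₚ.+-identityʳ k) c<k+0)))
hits-inside c k (suc n) k≤c c<k+n with c ≟ k
... | yes refl rewrite ≡ᵇ-refl c = cong suc (hits-outside c (suc c) n (inj₁ (ℕₚ.n<1+n c)))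
... | no  c≢k  rewrite ≢⇒≡ᵇ c≢k =
  hits-inside c (suc k) n (ℕₚ.≤∧≢⇒< k≤c (λ k≡c → c≢k (sym k≡c))) (subst (c <_) (ℕₚ.+-suc k n) c<k+n)

SegmentAt : List Mk → ℕ → List Mk → Set
SegmentAt msF k ms = ∀ i → i < length ms → lookupL msF (i + k) ≡ lookupL ms i

segment-tail : ∀ {msF k m ms} → SegmentAt msF k (m ∷ ms) → SegmentAt msF (suc k) ms
segment-tail {msF} {k} h i lt = trans (cong (lookupL msF) (ℕₚ.+-suc i k)) (h (suc i) (s≤s lt))

fullyMarked-cons : ∀ c ms x m → lookupL ms x ≡ just m → ∀ a →
  (unmarkedToRoot (mk c ms) (x ∷ a) ≡ᵇ 0) ≡ ((c ≡ᵇ x) ∧ (unmarkedToRoot m a ≡ᵇ 0))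
fullyMarked-cons c ms x m lk a rewrite unmarkedToRoot-cons c ms x m lk a with c ≡ᵇ x
... | true  = refl
... | false = refl

oneUnmarked-cons : ∀ c ms x m → lookupL ms x ≡ just m → c ≢ x → ∀ a →
  (unmarkedToRoot (mk c ms) (x ∷ a) ≡ᵇ 1) ≡ (unmarkedToRoot m a ≡ᵇ 0)
oneUnmarked-cons c ms x m lk c≢x a rewrite unmarkedToRoot-cons c ms x m lk a | ≢⇒≡ᵇ c≢x = refl

-- Following the marked edges from the root leads to exactly one terminal;
-- within a segment of children it is found below child c only.
mutual
  fullyMarked-unique : ∀ {s m} → Valid s m → count (λ b → unmarkedToRoot m b ≡ᵇ 0) (terms s) ≡ 1
  fullyMarked-unique valid-term = refl
  fullyMarked-unique {stein ts} {mk c ms} (valid-stein c<n vl) =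
    trans (fullyMarked-segment c ms 0 ts ms vl (λ i _ → cong (lookupL ms) (ℕₚ.+-identityʳ i)))
          (hits-inside c 0 (length ts) z≤n c<n)

  fullyMarked-segment : ∀ c msF k ts ms → ValidList ts ms → SegmentAt msF k ms →
    count (λ b → unmarkedToRoot (mk c msF) b ≡ᵇ 0) (termsL k ts) ≡ count (c ≡ᵇ_) (interval k (length ts))
  fullyMarked-segment c msF k []       []       []       h = refl
  fullyMarked-segment c msF k (t ∷ ts) (m ∷ ms) (v ∷ vl) h = begin
      count F (map (k ∷_) (terms t) ++ termsL (suc k) ts)
    ≡⟨ count-++ F (map (k ∷_) (terms t)) (termsL (suc k) ts) ⟩
      count F (map (k ∷_) (terms t)) + count F (termsL (suc k) ts)
    ≡⟨ cong₂ _+_ inBranch (fullyMarked-segment c msF (suc k) ts ms vl (segment-tail {msF} {k} {m} {ms} h)) ⟩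
      𝟙 (c ≡ᵇ k) + count (c ≡ᵇ_) (interval (suc k) (length ts))
    ∎
    where
    F = λ b → unmarkedToRoot (mk c msF) b ≡ᵇ 0
    inBranch : count F (map (k ∷_) (terms t)) ≡ 𝟙 (c ≡ᵇ k)
    inBranch = begin
        count F (map (k ∷_) (terms t))
      ≡⟨ count-map F (k ∷_) (terms t) ⟩
        count (λ a → F (k ∷ a)) (terms t)
      ≡⟨ count-cong (terms t) (universal (fullyMarked-cons c msF k m (h 0 (s≤s z≤n))) (terms t)) ⟩
        count (λ a → (c ≡ᵇ k) ∧ (unmarkedToRoot m a ≡ᵇ 0)) (terms t)
      ≡⟨ count-∧ (c ≡ᵇ k) _ (terms t) ⟩
        𝟙 (c ≡ᵇ k) * count (λ a → unmarkedToRoot m a ≡ᵇ 0) (terms t)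
      ≡⟨ cong (𝟙 (c ≡ᵇ k) *_) (fullyMarked-unique v) ⟩
        𝟙 (c ≡ᵇ k) * 1
      ≡⟨ ℕₚ.*-identityʳ _ ⟩
        𝟙 (c ≡ᵇ k)
      ∎

-- In a segment of unmarked children, exactly one terminal per child has a
-- single unmarked edge (the child edge) on its root path.
oneUnmarked-segment : ∀ c msF k ts ms → ValidList ts ms → SegmentAt msF k ms → Outside c k (length ts) →
  count (λ b → unmarkedToRoot (mk c msF) b ≡ᵇ 1) (termsL k ts) ≡ length ts
oneUnmarked-segment c msF k []       []       []       h out = refl
oneUnmarked-segment c msF k (t ∷ ts) (m ∷ ms) (v ∷ vl) h out =
  trans (count-++ F (map (k ∷_) (terms t)) (termsL (suc k) ts))
    (cong₂ _+_ (trans (count-map F (k ∷_) (terms t))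
                 (trans (count-cong (terms t) (universal (oneUnmarked-cons c msF k m (h 0 (s≤s z≤n)) (proj₁ (outside-step out))) (terms t)))
                        (fullyMarked-unique v)))
               (oneUnmarked-segment c msF (suc k) ts ms vl (segment-tail {msF} {k} {m} {ms} h) (proj₂ (outside-step out))))
  where F = λ b → unmarkedToRoot (mk c msF) b ≡ᵇ 1

termsL-offBranch : ∀ x k ts → Outside x k (length ts) → All (OffBranch x) (termsL k ts)
termsL-offBranch x k []       out = []
termsL-offBranch x k (t ∷ ts) out =
  ++⁺ (map⁺ (universal (λ _ k≡x → proj₁ (outside-step out) (sym k≡x)) (terms t)))
      (termsL-offBranch x (suc k) ts (proj₂ (outside-step out)))

termsL-++ : ∀ k xs ys → termsL k (xs ++ ys) ≡ termsL k xs ++ termsL (k + length xs) ys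
termsL-++ k []       ys = cong (λ z → termsL z ys) (sym (ℕₚ.+-identityʳ k))
termsL-++ k (t ∷ xs) ys rewrite termsL-++ (suc k) xs ys | ℕₚ.+-suc k (length xs) =
  sym (Listₚ.++-assoc (map (k ∷_) (terms t)) (termsL (suc k) xs) _)

lookup-split : {A : Set} (xs : List A) (x : ℕ) (y : A) → lookupL xs x ≡ just y →
  Σ (List A) λ pre → Σ (List A) λ post → (xs ≡ pre ++ y ∷ post) × (length pre ≡ x)
lookup-split (z ∷ xs) zero    y refl = [] , xs , refl , refl
lookup-split (z ∷ xs) (suc x) y eq with lookup-split xs x y eq
... | pre , post , xs≡ , len = z ∷ pre , post , cong (z ∷_) xs≡ , cong suc len

lookup-++ˡ : {A : Set} (xs ys : List A) (i : ℕ) → i < length xs → lookupL (xs ++ ys) i ≡ lookupL xs i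
lookup-++ˡ (x ∷ xs) ys zero    lt       = refl
lookup-++ˡ (x ∷ xs) ys (suc i) (s≤s lt) = lookup-++ˡ xs ys i lt

lookup-++ʳ : {A : Set} (xs ys : List A) (i : ℕ) → lookupL (xs ++ ys) (i + length xs) ≡ lookupL ys i
lookup-++ʳ []       ys i = cong (lookupL ys) (ℕₚ.+-identityʳ i)
lookup-++ʳ (x ∷ xs) ys i rewrite ℕₚ.+-suc i (length xs) = lookup-++ʳ xs ys i

lookup-bound : {A : Set} (xs : List A) (x : ℕ) {y : A} → lookupL xs x ≡ just y → x < length xs
lookup-bound (z ∷ xs) zero    eq = s≤s z≤n
lookup-bound (z ∷ xs) (suc x) eq = s≤s (lookup-bound xs x eq)

lookup-< : {A : Set} (xs : List A) (x : ℕ) → x < length xs → Σ A λ y → lookupL xs x ≡ just y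
lookup-< (y ∷ xs) zero    lt       = y , refl
lookup-< (y ∷ xs) (suc x) (s≤s lt) = lookup-< xs x lt

validList-split : ∀ pre t post mpre m mpost → ValidList (pre ++ t ∷ post) (mpre ++ m ∷ mpost) →
  length pre ≡ length mpre → ValidList pre mpre × Valid t m × ValidList post mpost
validList-split []        t post []         m mpost (v ∷ vl) _   = [] , v , vl
validList-split (_ ∷ pre) t post (_ ∷ mpre) m mpost (v ∷ vl) len
  with validList-split pre t post mpre m mpost vl (ℕₚ.suc-injective len)
... | vpre , vt , vpost = v ∷ vpre , vt , vpost

lookup-valid : ∀ {ts ms} → ValidList ts ms → ∀ x t → lookupL ts x ≡ just t →
  Σ Mk λ m → (lookupL ms x ≡ just m) × Valid t m
lookup-valid (_∷_ {m = m} v vl) zero    t refl = m , refl , v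
lookup-valid (v ∷ vl)           (suc x) t eq   = lookup-valid vl x t eq

-- For the child x of the root (subtree t, marking m) and
-- an edge e of t, the pairs witnessing x ∷ e in the whole tree are those
-- witnessing e inside t, plus pairs (a, b) with a the terminal of t reached
-- from t's root by marked edges through e (if any) and b outside t such that
-- the a–b path has one unmarked edge: n-1 choices of b if x is the marked
-- child (b hangs below another child edge), and otherwise exactly one (b is
-- reached from the root by marked edges).

reachThrough : Tree → Mk → List ℕ → ℕ
reachThrough s m e = count (λ a → onRootPath e a ∧ (unmarkedToRoot m a ≡ᵇ 0)) (terms s)

branchFactor : ℕ → ℕ → ℕ → ℕ
branchFactor n c x = if c ≡ᵇ x then n ∸ 1 else 1

private
  module Branch (pre : List Tree) (t : Tree) (post : List Tree) (mpre : List Mk) (m : Mk) (mpost : List Mk)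
                (c : ℕ) (len : length mpre ≡ length pre)
                (valid : Valid (stein (pre ++ t ∷ post)) (mk c (mpre ++ m ∷ mpost))) where

    x   = length pre
    ts  = pre ++ t ∷ post
    msF = mpre ++ m ∷ mpost
    M   = mk c msF
    K   = branchFactor (length ts) c x

    c<n : c < length ts
    c<n = valid-index valid

    vl : ValidList ts msF
    vl = valid-children valid

    parts = validList-split pre t post mpre m mpost vl (sym len)

    lookup-m : lookupL msF x ≡ just m
    lookup-m = subst (λ z → lookupL msF z ≡ just m) len (lookup-++ʳ mpre (m ∷ mpost) 0)

    seg-pre : SegmentAt msF 0 mpre
    seg-pre i lt = trans (cong (lookupL msF) (ℕₚ.+-identityʳ i)) (lookup-++ˡ mpre (m ∷ mpost) i lt)

    seg-post : SegmentAt msF (suc x) mpost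
    seg-post i lt = trans (cong (lookupL msF) (trans (ℕₚ.+-suc i x) (cong (λ z → suc i + z) (sym len))))
                          (lookup-++ʳ mpre (m ∷ mpost) (suc i))

    n≡ : length ts ≡ suc (x + length post)
    n≡ = trans (Listₚ.length-++ pre) (ℕₚ.+-suc x (length post))

    others = termsL 0 pre ++ termsL (suc x) post

    off-pre : All (OffBranch x) (termsL 0 pre)
    off-pre = termsL-offBranch x 0 pre (inj₂ ℕₚ.≤-refl)

    off-post : All (OffBranch x) (termsL (suc x) post)
    off-post = termsL-offBranch x (suc x) post (inj₁ (ℕₚ.n<1+n x))

    fullyMarked-others : count (λ b → unmarkedToRoot M b ≡ᵇ 0) others
                         ≡ count (c ≡ᵇ_) (interval 0 (length pre)) + count (c ≡ᵇ_) (interval (suc x) (length post))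
    fullyMarked-others = trans (count-++ _ (termsL 0 pre) (termsL (suc x) post))
      (cong₂ _+_ (fullyMarked-segment c msF 0 pre mpre (proj₁ parts) seg-pre)
                 (fullyMarked-segment c msF (suc x) post mpost (proj₂ (proj₂ parts)) seg-post))

    fullyMarked-others-≡ : c ≡ x → count (λ b → unmarkedToRoot M b ≡ᵇ 0) others ≡ 0
    fullyMarked-others-≡ refl = trans fullyMarked-others
      (cong₂ _+_ (hits-outside c 0 x (inj₂ ℕₚ.≤-refl)) (hits-outside c (suc x) (length post) (inj₁ (ℕₚ.n<1+n x))))

    fullyMarked-others-≢ : c ≢ x → count (λ b → unmarkedToRoot M b ≡ᵇ 0) others ≡ 1
    fullyMarked-others-≢ c≢x = trans fullyMarked-others (byPosition (ℕₚ.<-cmp c x))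
      where
      byPosition : Tri (c < x) (c ≡ x) (x < c) →
        count (c ≡ᵇ_) (interval 0 x) + count (c ≡ᵇ_) (interval (suc x) (length post)) ≡ 1
      byPosition (tri< c<x _ _) = cong₂ _+_ (hits-inside c 0 x z≤n c<x)
                                            (hits-outside c (suc x) (length post) (inj₁ (ℕₚ.m≤n⇒m≤1+n c<x)))
      byPosition (tri≈ _ c≡x _) = ⊥-elim (c≢x c≡x)
      byPosition (tri> _ _ x<c) = cong₂ _+_ (hits-outside c 0 x (inj₂ (ℕₚ.<⇒≤ x<c)))
                                            (hits-inside c (suc x) (length post) x<c (subst (c <_) n≡ c<n))

    oneUnmarked-others : c ≡ x → count (λ b → unmarkedToRoot M b ≡ᵇ 1) others ≡ length ts ∸ 1
    oneUnmarked-others refl = trans (count-++ _ (termsL 0 pre) (termsL (suc x) post))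
      (trans (cong₂ _+_ (oneUnmarked-segment c msF 0 pre mpre (proj₁ parts) seg-pre (inj₂ ℕₚ.≤-refl))
                        (oneUnmarked-segment c msF (suc x) post mpost (proj₂ (proj₂ parts)) seg-post (inj₁ (ℕₚ.n<1+n x))))
             (sym (cong (_∸ 1) n≡)))

    -- terminals b outside the branch completing a one-unmarked-edge path from a
    -- terminal a of t with u unmarked edges above it in t
    completions : ∀ u → count (λ b → (𝟙 (not (c ≡ᵇ x)) + u) + unmarkedToRoot M b ≡ᵇ 1) others ≡ 𝟙 (u ≡ᵇ 0) * K
    completions u with c ≟ x
    ... | yes c≡x rewrite dec-true (c ≟ x) c≡x = byCount u
      where
      byCount : ∀ u → count (λ b → u + unmarkedToRoot M b ≡ᵇ 1) others ≡ 𝟙 (u ≡ᵇ 0) * (length ts ∸ 1)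
      byCount zero          = trans (oneUnmarked-others c≡x) (sym (ℕₚ.+-identityʳ _))
      byCount (suc zero)    = fullyMarked-others-≡ c≡x
      byCount (suc (suc u)) = count-none others (universal (λ _ → refl) others)
    ... | no c≢x rewrite ≢⇒≡ᵇ c≢x = byCount u
      where
      byCount : ∀ u → count (λ b → suc u + unmarkedToRoot M b ≡ᵇ 1) others ≡ 𝟙 (u ≡ᵇ 0) * 1
      byCount zero    = fullyMarked-others-≢ c≢x
      byCount (suc u) = count-none others (universal (λ _ → refl) others)

    crossing : ∀ e a → count (witnesses M (x ∷ e) (x ∷ a)) others ≡ 𝟙 (onRootPath e a ∧ (unmarkedToRoot m a ≡ᵇ 0)) * K
    crossing e a = begin
        count (witnesses M (x ∷ e) (x ∷ a)) others
      ≡⟨ count-cong others (All-map (λ {b} → witnesses-off M x e a b) (++⁺ off-pre off-post)) ⟩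
        count (λ b → onRootPath e a ∧ (unmarkedToRoot M (x ∷ a) + unmarkedToRoot M b ≡ᵇ 1)) others
      ≡⟨ count-∧ (onRootPath e a) _ others ⟩
        𝟙 (onRootPath e a) * count (λ b → unmarkedToRoot M (x ∷ a) + unmarkedToRoot M b ≡ᵇ 1) others
      ≡⟨ cong (λ z → 𝟙 (onRootPath e a) * count (λ b → z + unmarkedToRoot M b ≡ᵇ 1) others)
              (unmarkedToRoot-cons c msF x m lookup-m a) ⟩
        𝟙 (onRootPath e a) * count (λ b → (𝟙 (not (c ≡ᵇ x)) + unmarkedToRoot m a) + unmarkedToRoot M b ≡ᵇ 1) others
      ≡⟨ cong (𝟙 (onRootPath e a) *_) (completions (unmarkedToRoot m a)) ⟩
        𝟙 (onRootPath e a) * (𝟙 (unmarkedToRoot m a ≡ᵇ 0) * K)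
      ≡⟨ sym (trans (cong (_* K) (𝟙-∧ (onRootPath e a) _)) (ℕₚ.*-assoc (𝟙 (onRootPath e a)) _ K)) ⟩
        𝟙 (onRootPath e a ∧ (unmarkedToRoot m a ≡ᵇ 0)) * K
      ∎

    inside : ∀ e → countPairs (witnesses M (x ∷ e)) (map (x ∷_) (terms t)) ≡ w t m e
    inside e = begin
        count (λ q → P (proj₁ q) (proj₂ q)) (pairs (map (x ∷_) (terms t)))
      ≡⟨ cong (count (λ q → P (proj₁ q) (proj₂ q))) (pairs-map (x ∷_) (terms t)) ⟩
        count (λ q → P (proj₁ q) (proj₂ q)) (map _ (pairs (terms t)))
      ≡⟨ count-map _ _ (pairs (terms t)) ⟩
        count (λ q → P (x ∷ proj₁ q) (x ∷ proj₂ q)) (pairs (terms t))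
      ≡⟨ count-cong (pairs (terms t)) (universal (λ q → witnesses-same c msF x m lookup-m e (proj₁ q) (proj₂ q)) (pairs (terms t))) ⟩
        countPairs (witnesses m e) (terms t)
      ≡⟨ sym (w≡countPairs t m e) ⟩
        w t m e
      ∎
      where P = witnesses M (x ∷ e)

    w-branch : ∀ e → w (stein ts) M (x ∷ e) ≡ w t m e + reachThrough t m e * K
    w-branch e = begin
        w (stein ts) M (x ∷ e)
      ≡⟨ w≡countPairs (stein ts) M (x ∷ e) ⟩
        countPairs P (termsL 0 (pre ++ t ∷ post))
      ≡⟨ cong (countPairs P) (termsL-++ 0 pre (t ∷ post)) ⟩
        countPairs P (termsL 0 pre ++ (map (x ∷_) (terms t) ++ termsL (suc x) post))
      ≡⟨ countPairs-around P (OffBranch x) (witnesses-sym M (x ∷ e)) (witnesses-outer M x e)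
           (termsL 0 pre) (map (x ∷_) (terms t)) (termsL (suc x) post) off-pre off-post ⟩
        countPairs P (map (x ∷_) (terms t)) + sumOver (λ a → count (P a) others) (map (x ∷_) (terms t))
      ≡⟨ cong₂ _+_ (inside e) (trans (sumOver-map (λ a → count (P a) others) (x ∷_) (terms t))
                                     (sumOver-cong (terms t) (universal (crossing e) (terms t)))) ⟩
        w t m e + sumOver (λ a → 𝟙 (onRootPath e a ∧ (unmarkedToRoot m a ≡ᵇ 0)) * K) (terms t)
      ≡⟨ cong (w t m e +_) (trans (sumOver-*ʳ _ K (terms t)) (cong (_* K) (sym (count-as-sum _ (terms t))))) ⟩
        w t m e + reachThrough t m e * K
      ∎
      where P = witnesses M (x ∷ e)

    reachThrough-branch : ∀ e → reachThrough (stein ts) M (x ∷ e) ≡ 𝟙 (c ≡ᵇ x) * reachThrough t m e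
    reachThrough-branch e = begin
        count F (termsL 0 (pre ++ t ∷ post))
      ≡⟨ cong (count F) (termsL-++ 0 pre (t ∷ post)) ⟩
        count F (termsL 0 pre ++ (map (x ∷_) (terms t) ++ termsL (suc x) post))
      ≡⟨ count-++ F (termsL 0 pre) _ ⟩
        count F (termsL 0 pre) + count F (map (x ∷_) (terms t) ++ termsL (suc x) post)
      ≡⟨ cong (count F (termsL 0 pre) +_) (count-++ F (map (x ∷_) (terms t)) (termsL (suc x) post)) ⟩
        count F (termsL 0 pre) + (count F (map (x ∷_) (terms t)) + count F (termsL (suc x) post))
      ≡⟨ cong₂ (λ u v → u + (count F (map (x ∷_) (terms t)) + v))
              (count-none (termsL 0 pre) (All-map (λ {b} → outside {b}) off-pre))
              (count-none (termsL (suc x) post) (All-map (λ {b} → outside {b}) off-post)) ⟩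
        count F (map (x ∷_) (terms t)) + 0
      ≡⟨ ℕₚ.+-identityʳ _ ⟩
        count F (map (x ∷_) (terms t))
      ≡⟨ count-map F (x ∷_) (terms t) ⟩
        count (λ a → F (x ∷ a)) (terms t)
      ≡⟨ count-cong (terms t) (universal inBranch (terms t)) ⟩
        count (λ a → (c ≡ᵇ x) ∧ (onRootPath e a ∧ (unmarkedToRoot m a ≡ᵇ 0))) (terms t)
      ≡⟨ count-∧ (c ≡ᵇ x) _ (terms t) ⟩
        𝟙 (c ≡ᵇ x) * reachThrough t m e
      ∎
      where
      F = λ a → onRootPath (x ∷ e) a ∧ (unmarkedToRoot M a ≡ᵇ 0)
      outside : ∀ {b} → OffBranch x b → F b ≡ false
      outside {b} off rewrite memL-prefixes-off x e b off = refl
      swap : ∀ p q r → p ∧ (q ∧ r) ≡ q ∧ (p ∧ r)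
      swap true  q     r = refl
      swap false true  r = refl
      swap false false r = refl
      inBranch : ∀ a → F (x ∷ a) ≡ (c ≡ᵇ x) ∧ (onRootPath e a ∧ (unmarkedToRoot m a ≡ᵇ 0))
      inBranch a rewrite fullyMarked-cons c msF x m lookup-m a | memL-map-cons x e ([] ∷ prefixes a) =
        swap (onRootPath e a) (c ≡ᵇ x) (unmarkedToRoot m a ≡ᵇ 0)

w-child : ∀ ts c ms x t m e → Valid (stein ts) (mk c ms) → lookupL ts x ≡ just t → lookupL ms x ≡ just m →
  w (stein ts) (mk c ms) (x ∷ e) ≡ w t m e + reachThrough t m e * branchFactor (length ts) c x
w-child ts c ms x t m e v lt lm with lookup-split ts x t lt | lookup-split ms x m lm
... | pre , post , refl , refl | mpre , mpost , refl , len = Branch.w-branch pre t post mpre m mpost c len v e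

reachThrough-child : ∀ ts c ms x t m e → Valid (stein ts) (mk c ms) → lookupL ts x ≡ just t → lookupL ms x ≡ just m →
  reachThrough (stein ts) (mk c ms) (x ∷ e) ≡ 𝟙 (c ≡ᵇ x) * reachThrough t m e
reachThrough-child ts c ms x t m e v lt lm with lookup-split ts x t lt | lookup-split ms x m lm
... | pre , post , refl , refl | mpre , mpost , refl , len = Branch.reachThrough-branch pre t post mpre m mpost c len v e

-- the root itself is on no path, and every fully marked path passes the empty edge
w-root : ∀ s m → w s m [] ≡ 0
w-root s m = trans (w≡countPairs s m [])
  (count-none (pairs (terms s))
    (universal (λ q → cong (_∧ (unmarkedOn m (proj₁ q) (proj₂ q) ≡ᵇ 1))
                           (memL-nil (pathEdges (proj₁ q) (proj₂ q)) (pathEdges-nonEmpty (proj₁ q) (proj₂ q))))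
               (pairs (terms s))))

reachThrough-root : ∀ {s m} → Valid s m → reachThrough s m [] ≡ 1
reachThrough-root = fullyMarked-unique

fromℚᵘ-+ : ∀ x y → fromℚᵘ (x +ᵘ y) ≡ fromℚᵘ x +ℚ fromℚᵘ y
fromℚᵘ-+ x y = ℚₚ.toℚᵘ-injective (ℚᵘₚ.≃-trans (ℚₚ.toℚᵘ-fromℚᵘ (x +ᵘ y))
  (ℚᵘₚ.≃-sym (ℚᵘₚ.≃-trans (ℚₚ.toℚᵘ-homo-+ (fromℚᵘ x) (fromℚᵘ y)) (ℚᵘₚ.+-cong (ℚₚ.toℚᵘ-fromℚᵘ x) (ℚₚ.toℚᵘ-fromℚᵘ y)))))

fromℚᵘ-* : ∀ x y → fromℚᵘ (x *ᵘ y) ≡ fromℚᵘ x *ℚ fromℚᵘ y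
fromℚᵘ-* x y = ℚₚ.toℚᵘ-injective (ℚᵘₚ.≃-trans (ℚₚ.toℚᵘ-fromℚᵘ (x *ᵘ y))
  (ℚᵘₚ.≃-sym (ℚᵘₚ.≃-trans (ℚₚ.toℚᵘ-homo-* (fromℚᵘ x) (fromℚᵘ y)) (ℚᵘₚ.*-cong (ℚₚ.toℚᵘ-fromℚᵘ x) (ℚₚ.toℚᵘ-fromℚᵘ y)))))

ℕ→ℚ-+ : ∀ a b → ℕ→ℚ (a + b) ≡ ℕ→ℚ a +ℚ ℕ→ℚ b
ℕ→ℚ-+ a b = trans (ℚₚ.fromℚᵘ-cong {mkℚᵘ (ℤ+ (a + b)) 0} {mkℚᵘ (ℤ+ a) 0 +ᵘ mkℚᵘ (ℤ+ b) 0} (*≡* cross))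
                  (fromℚᵘ-+ (mkℚᵘ (ℤ+ a) 0) (mkℚᵘ (ℤ+ b) 0))
  where
  cross : (ℤ+ (a + b)) *ℤ (ℤ+ 1) ≡ ((ℤ+ a) *ℤ (ℤ+ 1) +ℤ (ℤ+ b) *ℤ (ℤ+ 1)) *ℤ (ℤ+ 1)
  cross rewrite ℤₚ.*-identityʳ (ℤ+ (a + b)) | ℤₚ.*-identityʳ (ℤ+ a) | ℤₚ.*-identityʳ (ℤ+ b)
              | ℤₚ.*-identityʳ (ℤ+ a +ℤ ℤ+ b) = refl

ℕ→ℚ-suc : ∀ k → ℕ→ℚ (suc k) ≡ 1ℚ +ℚ ℕ→ℚ k
ℕ→ℚ-suc k = ℕ→ℚ-+ 1 k

ℕ→ℚ*recip : ∀ n → ℕ→ℚ (suc n) *ℚ recip (suc n) ≡ 1ℚ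
ℕ→ℚ*recip n = trans (sym (fromℚᵘ-* (mkℚᵘ (ℤ+ (suc n)) 0) (mkℚᵘ (ℤ+ 1) n)))
                    (ℚₚ.fromℚᵘ-cong {mkℚᵘ (ℤ+ (suc n)) 0 *ᵘ mkℚᵘ (ℤ+ 1) n} {mkℚᵘ (ℤ+ 1) 0} (*≡* cross))
  where
  cross : ((ℤ+ (suc n)) *ℤ (ℤ+ 1)) *ℤ (ℤ+ 1) ≡ (ℤ+ 1) *ℤ (ℤ+ (1 * suc n))
  cross = cong (λ z → ℤ+ (suc z)) (trans (ℕₚ.*-identityʳ (n * 1)) (trans (ℕₚ.*-identityʳ n)
                                      (sym (trans (ℕₚ.+-identityʳ (n + 0)) (ℕₚ.+-identityʳ n)))))

-- 1/(ab) = (1/a)(1/b), including the convention 1/0 = 0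
recip-* : ∀ a b → recip (a * b) ≡ recip a *ℚ recip b
recip-* zero    b    = sym (ℚₚ.*-zeroˡ (recip b))
recip-* (suc a) zero rewrite ℕₚ.*-zeroʳ a = sym (ℚₚ.*-zeroʳ (recip (suc a)))
recip-* (suc a) (suc b) =
  trans (ℚₚ.fromℚᵘ-cong {mkℚᵘ (ℤ+ 1) (b + a * suc b)} {mkℚᵘ (ℤ+ 1) a *ᵘ mkℚᵘ (ℤ+ 1) b} (*≡* refl))
        (fromℚᵘ-* (mkℚᵘ (ℤ+ 1) a) (mkℚᵘ (ℤ+ 1) b))

sumℚ : List ℚ → ℚ
sumℚ = foldr _+ℚ_ 0ℚ

expect : {A : Set} → List (ℚ × A) → (A → ℚ) → ℚ
expect D g = sumℚ (map (λ pm → proj₁ pm *ℚ g (proj₂ pm)) D)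

sumℚ-++ : ∀ xs ys → sumℚ (xs ++ ys) ≡ sumℚ xs +ℚ sumℚ ys
sumℚ-++ []       ys = sym (ℚₚ.+-identityˡ _)
sumℚ-++ (x ∷ xs) ys = trans (cong (x +ℚ_) (sumℚ-++ xs ys)) (sym (ℚₚ.+-assoc x _ _))

sumℚ-scale : {A : Set} (r : ℚ) (f : A → ℚ) (xs : List A) → sumℚ (map (λ x → r *ℚ f x) xs) ≡ r *ℚ sumℚ (map f xs)
sumℚ-scale r f []       = sym (ℚₚ.*-zeroʳ r)
sumℚ-scale r f (x ∷ xs) = trans (cong (r *ℚ f x +ℚ_) (sumℚ-scale r f xs)) (sym (ℚₚ.*-distribˡ-+ r (f x) _))

sumℚ-const : {A : Set} (v : ℚ) (xs : List A) → sumℚ (map (λ _ → v) xs) ≡ ℕ→ℚ (length xs) *ℚ v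
sumℚ-const v []       = sym (ℚₚ.*-zeroˡ v)
sumℚ-const v (x ∷ xs) = begin
    v +ℚ sumℚ (map (λ _ → v) xs)
  ≡⟨ cong (v +ℚ_) (sumℚ-const v xs) ⟩
    v +ℚ ℕ→ℚ (length xs) *ℚ v
  ≡⟨ cong (_+ℚ ℕ→ℚ (length xs) *ℚ v) (sym (ℚₚ.*-identityˡ v)) ⟩
    1ℚ *ℚ v +ℚ ℕ→ℚ (length xs) *ℚ v
  ≡⟨ sym (ℚₚ.*-distribʳ-+ v 1ℚ (ℕ→ℚ (length xs))) ⟩
    (1ℚ +ℚ ℕ→ℚ (length xs)) *ℚ v
  ≡⟨ cong (_*ℚ v) (sym (ℕ→ℚ-suc (length xs))) ⟩
    ℕ→ℚ (suc (length xs)) *ℚ v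
  ∎

average-const : ∀ {A : Set} (xs : List A) (n : ℕ) → length xs ≡ suc n → (v : ℚ) →
  sumℚ (map (λ _ → recip (length xs) *ℚ v) xs) ≡ v
average-const xs n len v = begin
    sumℚ (map (λ _ → recip (length xs) *ℚ v) xs)
  ≡⟨ sumℚ-const (recip (length xs) *ℚ v) xs ⟩
    ℕ→ℚ (length xs) *ℚ (recip (length xs) *ℚ v)
  ≡⟨ sym (ℚₚ.*-assoc (ℕ→ℚ (length xs)) _ v) ⟩
    (ℕ→ℚ (length xs) *ℚ recip (length xs)) *ℚ v
  ≡⟨ cong (λ k → (ℕ→ℚ k *ℚ recip k) *ℚ v) len ⟩
    (ℕ→ℚ (suc n) *ℚ recip (suc n)) *ℚ v
  ≡⟨ cong (_*ℚ v) (ℕ→ℚ*recip n) ⟩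
    1ℚ *ℚ v
  ≡⟨ ℚₚ.*-identityˡ v ⟩
    v
  ∎

expect-concatMap : {A C : Set} (F : C → List (ℚ × A)) (g : A → ℚ) (xs : List C) →
  expect (concatMap F xs) g ≡ sumℚ (map (λ x → expect (F x) g) xs)
expect-concatMap F g []       = refl
expect-concatMap F g (x ∷ xs) = trans (cong sumℚ (Listₚ.map-++ _ (F x) (concatMap F xs)))
  (trans (sumℚ-++ (map _ (F x)) _) (cong (expect (F x) g +ℚ_) (expect-concatMap F g xs)))

expect-scaled : {A C : Set} (r : ℚ) (k : A → C) (g : C → ℚ) (D : List (ℚ × A)) →
  expect (map (λ pm → (r *ℚ proj₁ pm , k (proj₂ pm))) D) g ≡ r *ℚ expect D (λ y → g (k y))
expect-scaled r k g D = trans (sym (cong sumℚ (Listₚ.map-∘ D)))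
  (trans (cong sumℚ (Listₚ.map-cong (λ pm → ℚₚ.*-assoc r (proj₁ pm) _) D)) (sumℚ-scale r _ D))

expect-cong : {A : Set} {f g : A → ℚ} (D : List (ℚ × A)) → All (λ pm → f (proj₂ pm) ≡ g (proj₂ pm)) D →
  expect D f ≡ expect D g
expect-cong D eqs = cong sumℚ (Listₚ.map-cong-local (All-map (λ {pm} e → cong (proj₁ pm *ℚ_) e) eqs))

expect-congU : {A : Set} {f g : A → ℚ} (D : List (ℚ × A)) → (∀ a → f a ≡ g a) → expect D f ≡ expect D g
expect-congU D eq = cong sumℚ (Listₚ.map-cong (λ pm → cong (proj₁ pm *ℚ_) (eq (proj₂ pm))) D)

expect-const : {A : Set} (D : List (ℚ × A)) (v : ℚ) → expect D (λ _ → v) ≡ expect D (λ _ → 1ℚ) *ℚ v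
expect-const D v = trans (cong sumℚ (Listₚ.map-cong (λ pm → trans (cong (proj₁ pm *ℚ_) (sym (ℚₚ.*-identityˡ v)))
                                                            (trans (sym (ℚₚ.*-assoc (proj₁ pm) 1ℚ v)) (ℚₚ.*-comm _ v))) D))
                         (trans (sumℚ-scale v _ D) (ℚₚ.*-comm v _))

E-stein : ∀ ts f → E (stein ts) f ≡
  sumℚ (map (λ c → recip (length (allowed ts)) *ℚ expect (markDistL ts) (λ ms → f (mk c ms))) (allowed ts))
E-stein ts f = trans (expect-concatMap _ f (allowed ts))
  (cong sumℚ (Listₚ.map-cong (λ c → expect-scaled (recip (length (allowed ts))) (mk c) f (markDistL ts)) (allowed ts)))

expectL-cons : ∀ t ts (g : List Mk → ℚ) → expect (markDistL (t ∷ ts)) g ≡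
  expect (markDist t) (λ m → expect (markDistL ts) (λ ms → g (m ∷ ms)))
expectL-cons t ts g = trans (expect-concatMap _ g (markDist t))
  (cong sumℚ (Listₚ.map-cong (λ pm → expect-scaled (proj₁ pm) (proj₂ pm ∷_) g (markDistL ts)) (markDist t)))

expectL-nil : ∀ (g : List Mk → ℚ) → expect (markDistL []) g ≡ g []
expectL-nil g = trans (ℚₚ.+-identityʳ _) (ℚₚ.*-identityˡ _)

nonEmptyOr : List ℕ → List ℕ → List ℕ
nonEmptyOr []       r = r
nonEmptyOr (x ∷ xs) r = x ∷ xs

allowed≡ : ∀ ts → allowed ts ≡ nonEmptyOr (termIdx 0 ts) (range 0 (length ts ∸ 1))
allowed≡ ts with termIdx 0 ts
... | []     = refl
... | x ∷ xs = refl

termIdx-suc : ∀ k ts → termIdx (suc k) ts ≡ map suc (termIdx k ts)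
termIdx-suc k []            = refl
termIdx-suc k (term ∷ ts)    = cong (suc k ∷_) (termIdx-suc (suc k) ts)
termIdx-suc k (stein _ ∷ ts) = termIdx-suc (suc k) ts

termIdx-terminal : ∀ ts → All (λ c → lookupL ts c ≡ just term) (termIdx 0 ts)
termIdx-terminal []             = []
termIdx-terminal (term ∷ ts)    = refl ∷ subst (All _) (sym (termIdx-suc 0 ts)) (map⁺ (termIdx-terminal ts))
termIdx-terminal (stein u ∷ ts) = subst (All _) (sym (termIdx-suc 0 ts)) (map⁺ (termIdx-terminal ts))

suc-pred : ∀ n → 1 ≤ n → suc (n ∸ 1) ≡ n
suc-pred (suc n) _ = refl

allChildren≡ : ∀ n → 1 ≤ n → range 0 (n ∸ 1) ≡ upTo n
allChildren≡ (suc n) _ = Listₚ.map-id (upTo (suc n))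

allowed-bound : ∀ ts → 1 ≤ length ts → All (_< length ts) (allowed ts)
allowed-bound ts 1≤n rewrite allowed≡ ts with termIdx 0 ts | termIdx-terminal ts
... | []     | _     rewrite allChildren≡ (length ts) 1≤n = applyUpTo⁺₁ (λ k → k) (length ts) (λ lt → lt)
... | c ∷ cs | terms = All-map (λ {c} → lookup-bound ts c) terms

allowed-nonempty : ∀ ts → 1 ≤ length ts → Σ ℕ λ n → length (allowed ts) ≡ suc n
allowed-nonempty ts 1≤n rewrite allowed≡ ts with termIdx 0 ts
... | []     = length ts ∸ 1 , trans (cong length (allChildren≡ (length ts) 1≤n))
                                    (trans (Listₚ.length-upTo (length ts)) (sym (suc-pred (length ts) 1≤n)))
... | c ∷ cs = length cs , refl

mutual
  markDist-mass : ∀ {t} → WF t → expect (markDist t) (λ _ → 1ℚ) ≡ 1ℚ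
  markDist-mass wf-term = refl
  markDist-mass (wf-stein {ts} 1≤n _ wfs) with allowed-nonempty ts 1≤n
  ... | n , len = begin
      E (stein ts) (λ _ → 1ℚ)
    ≡⟨ E-stein ts (λ _ → 1ℚ) ⟩
      sumℚ (map (λ c → recip (length (allowed ts)) *ℚ expect (markDistL ts) (λ _ → 1ℚ)) (allowed ts))
    ≡⟨ cong (λ z → sumℚ (map (λ c → recip (length (allowed ts)) *ℚ z) (allowed ts))) (markDistL-mass wfs) ⟩
      sumℚ (map (λ c → recip (length (allowed ts)) *ℚ 1ℚ) (allowed ts))
    ≡⟨ average-const (allowed ts) n len 1ℚ ⟩
      1ℚ
    ∎

  markDistL-mass : ∀ {ts} → All WF ts → expect (markDistL ts) (λ _ → 1ℚ) ≡ 1ℚ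
  markDistL-mass []                 = expectL-nil (λ _ → 1ℚ)
  markDistL-mass {t ∷ ts} (wf ∷ wfs) =
    trans (expectL-cons t ts (λ _ → 1ℚ)) (trans (expect-congU (markDist t) (λ _ → markDistL-mass wfs)) (markDist-mass wf))

expect-constant : ∀ {t} → WF t → (v : ℚ) → expect (markDist t) (λ _ → v) ≡ v
expect-constant {t} wf v = trans (expect-const (markDist t) v) (trans (cong (_*ℚ v) (markDist-mass wf)) (ℚₚ.*-identityˡ v))

mutual
  markDist-valid : ∀ {t} → WF t → All (λ pm → Valid t (proj₂ pm)) (markDist t)
  markDist-valid wf-term = valid-term ∷ []
  markDist-valid (wf-stein {ts} 1≤n _ wfs) =
    concat⁺ (gmap⁺ (λ c<n → gmap⁺ (valid-stein c<n) (markDistL-valid wfs)) (allowed-bound ts 1≤n))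

  markDistL-valid : ∀ {ts} → All WF ts → All (λ pm → ValidList ts (proj₂ pm)) (markDistL ts)
  markDistL-valid []         = [] ∷ []
  markDistL-valid (wf ∷ wfs) = concat⁺ (gmap⁺ (λ v → gmap⁺ (v ∷_) (markDistL-valid wfs)) (markDist-valid wf))

expectL-child : ∀ ts x t (g : Maybe Mk → ℚ) → All WF ts → lookupL ts x ≡ just t →
  expect (markDistL ts) (λ ms → g (lookupL ms x)) ≡ expect (markDist t) (λ m → g (just m))
expectL-child (t₀ ∷ ts) zero t g (wf ∷ wfs) refl = trans (expectL-cons t₀ ts _)
  (expect-congU (markDist t₀) (λ m → trans (expect-const (markDistL ts) (g (just m)))
                                            (trans (cong (_*ℚ g (just m)) (markDistL-mass wfs)) (ℚₚ.*-identityˡ _))))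
expectL-child (t₀ ∷ ts) (suc x) t g (wf ∷ wfs) eq = trans (expectL-cons t₀ ts _)
  (trans (expect-congU (markDist t₀) (λ m → expectL-child ts x t g wfs eq)) (expect-constant wf _))

-- For the Steiner node ℓ at position p we track the
-- joint law of w(m(ℓ)) and of the number of terminals reached from the root
-- through m(ℓ) by marked edges, via expectations of observables G of both.

wMarked : Tree → Mk → List ℕ → ℕ
wMarked s m p = w s m (p ++ [ choiceAt m p ])

reachMarked : Tree → Mk → List ℕ → ℕ
reachMarked s m p = reachThrough s m (p ++ [ choiceAt m p ])

expectAt : Tree → List ℕ → (ℕ → ℕ → ℚ) → ℚ
expectAt s p G = E s (λ m → G (wMarked s m p) (reachMarked s m p))

-- the observable seen from the child x of a root with n children that marks child c
viaChoice : (ℕ → ℕ → ℚ) → ℕ → ℕ → ℕ → ℕ → ℕ → ℚ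
viaChoice G n x c v z = G (v + z * branchFactor n c x) (𝟙 (c ≡ᵇ x) * z)

expectAt-child : ∀ ts x t p G → WF (stein ts) → lookupL ts x ≡ just t →
  expectAt (stein ts) (x ∷ p) G
  ≡ sumℚ (map (λ c → recip (length (allowed ts)) *ℚ expectAt t p (viaChoice G (length ts) x c)) (allowed ts))
expectAt-child ts x t p G (wf-stein 1≤n _ wfs) lt = trans (E-stein ts _)
  (cong sumℚ (Listₚ.map-cong-local (All-map (λ {c} c<n → cong (recip (length (allowed ts)) *ℚ_) (perChoice c c<n))
                                            (allowed-bound ts 1≤n))))
  where
  observed : ℕ → Maybe Mk → ℚ
  observed c (just m) = viaChoice G (length ts) x c (wMarked t m p) (reachMarked t m p)
  observed c nothing  = 0ℚ
  pointwise : ∀ c ms → c < length ts → ValidList ts ms →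
    G (wMarked (stein ts) (mk c ms) (x ∷ p)) (reachMarked (stein ts) (mk c ms) (x ∷ p)) ≡ observed c (lookupL ms x)
  pointwise c ms c<n vl with lookup-valid vl x t lt
  ... | m , lm , _ rewrite lm =
    cong₂ G (w-child ts c ms x t m _ (valid-stein c<n vl) lt lm) (reachThrough-child ts c ms x t m _ (valid-stein c<n vl) lt lm)
  perChoice : ∀ c → c < length ts →
    expect (markDistL ts) (λ ms → G (wMarked (stein ts) (mk c ms) (x ∷ p)) (reachMarked (stein ts) (mk c ms) (x ∷ p)))
    ≡ expectAt t p (viaChoice G (length ts) x c)
  perChoice c c<n = trans (expect-cong (markDistL ts) (All-map (λ {pm} vl → pointwise c (proj₂ pm) c<n vl) (markDistL-valid wfs)))
                          (expectL-child ts x t (observed c) wfs lt)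

-- at the root, the marked edge is witnessed by its n-1 sibling terminals
expectAt-root : ∀ ts G → WF (stein ts) → expectAt (stein ts) [] G ≡ G (length ts ∸ 1) 1
expectAt-root ts G wf = trans (expect-cong (markDist (stein ts)) (All-map (λ {pm} v → pointwise (proj₂ pm) v) (markDist-valid wf)))
                              (expect-constant wf _)
  where
  pointwise : ∀ m → Valid (stein ts) m → G (wMarked (stein ts) m []) (reachMarked (stein ts) m []) ≡ G (length ts ∸ 1) 1
  pointwise (mk c ms) (valid-stein c<n vl) with lookup-< ts c c<n
  ... | t , lt with lookup-valid vl c t lt
  ...   | m , lm , vm = cong₂ G
          (trans (w-child ts c ms c t m [] (valid-stein c<n vl) lt lm)
            (trans (cong₂ (λ a b → a + b * branchFactor (length ts) c c) (w-root t m) (reachThrough-root vm))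
              (trans (ℕₚ.+-identityʳ (branchFactor (length ts) c c)) (cong (λ z → if z then length ts ∸ 1 else 1) (≡ᵇ-refl c)))))
          (trans (reachThrough-child ts c ms c t m [] (valid-stein c<n vl) lt lm)
            (cong₂ (λ a b → 𝟙 a * b) (≡ᵇ-refl c) (reachThrough-root vm)))

range-snoc : ∀ a b → a ≤ suc b → range a (suc b) ≡ range a b ++ [ suc b ]
range-snoc a b a≤ = begin
    map (a +_) (upTo (suc (suc b) ∸ a))
  ≡⟨ cong (λ z → map (a +_) (upTo z)) (ℕₚ.+-∸-assoc 1 a≤) ⟩
    map (a +_) (upTo (suc (suc b ∸ a)))
  ≡⟨ cong (map (a +_)) (sym (Listₚ.upTo-∷ʳ (suc b ∸ a))) ⟩
    map (a +_) (upTo (suc b ∸ a) ++ [ suc b ∸ a ])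
  ≡⟨ Listₚ.map-++ (a +_) (upTo (suc b ∸ a)) [ suc b ∸ a ] ⟩
    range a b ++ [ a + (suc b ∸ a) ]
  ≡⟨ cong (λ z → range a b ++ [ z ]) (ℕₚ.m+[n∸m]≡n a≤) ⟩
    range a b ++ [ suc b ]
  ∎

Σℚ-snoc : ∀ a b f → a ≤ suc b → Σℚ a (suc b) f ≡ Σℚ a b f +ℚ f (suc b)
Σℚ-snoc a b f a≤ rewrite range-snoc a b a≤ | Listₚ.map-++ f (range a b) [ suc b ]
  | sumℚ-++ (map f (range a b)) [ f (suc b) ] | ℚₚ.+-identityʳ (f (suc b)) = refl

Σℕ-snoc : ∀ a b f → a ≤ suc b → Σℕ a (suc b) f ≡ Σℕ a b f + f (suc b)
Σℕ-snoc a b f a≤ rewrite range-snoc a b a≤ | Listₚ.map-++ f (range a b) [ suc b ]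
  | ListActionₚ.sum-++ (map f (range a b)) [ f (suc b) ] | ℕₚ.+-identityʳ (f (suc b)) = refl

Πℕ-snoc : ∀ a b f → a ≤ suc b → Πℕ a (suc b) f ≡ Πℕ a b f * f (suc b)
Πℕ-snoc a b f a≤ rewrite range-snoc a b a≤ | Listₚ.map-++ f (range a b) [ suc b ]
  | ListActionₚ.product-++ (map f (range a b)) [ f (suc b) ] | ℕₚ.*-identityʳ (f (suc b)) = refl

range-bounds : ∀ a b → All (λ h → a ≤ h × h ≤ b) (range a b)
range-bounds a b = gmap⁺ (λ {i} lt → ℕₚ.m≤m+n a i , ℕₚ.≤-pred (shift a i (suc b) lt))
                         (applyUpTo⁺₁ (λ k → k) (suc b ∸ a) (λ lt → lt))
  where
  shift : ∀ a i m → i < m ∸ a → a + i < m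
  shift zero    i m       lt = lt
  shift (suc a) i (suc m) lt = s≤s (shift a i m lt)

Σℚ-congR : ∀ a b {f g : ℕ → ℚ} → (∀ h → a ≤ h → h ≤ b → f h ≡ g h) → Σℚ a b f ≡ Σℚ a b g
Σℚ-congR a b eq = cong sumℚ (Listₚ.map-cong-local (All-map (λ p → eq _ (proj₁ p) (proj₂ p)) (range-bounds a b)))

Σℕ-congR : ∀ a b {f g : ℕ → ℕ} → (∀ h → a ≤ h → h ≤ b → f h ≡ g h) → Σℕ a b f ≡ Σℕ a b g
Σℕ-congR a b eq = cong sum (Listₚ.map-cong-local (All-map (λ p → eq _ (proj₁ p) (proj₂ p)) (range-bounds a b)))

Πℕ-congR : ∀ a b {f g : ℕ → ℕ} → (∀ h → a ≤ h → h ≤ b → f h ≡ g h) → Πℕ a b f ≡ Πℕ a b g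
Πℕ-congR a b eq = cong (foldr _*_ 1) (Listₚ.map-cong-local (All-map (λ p → eq _ (proj₁ p) (proj₂ p)) (range-bounds a b)))

Σℚ-cong : ∀ a b {f g : ℕ → ℚ} → (∀ h → f h ≡ g h) → Σℚ a b f ≡ Σℚ a b g
Σℚ-cong a b eq = cong sumℚ (Listₚ.map-cong eq (range a b))

Σℕ-≥ : ∀ d j → (∀ i → 1 ≤ i → i ≤ j → 1 ≤ d i) → j ≤ Σℕ 1 j d
Σℕ-≥ d zero    pos = z≤n
Σℕ-≥ d (suc j) pos = subst (suc j ≤_) (sym (Σℕ-snoc 1 j d (s≤s z≤n)))
  (subst (_≤ Σℕ 1 j d + d (suc j)) (ℕₚ.+-comm j 1)
    (ℕₚ.+-mono-≤ (Σℕ-≥ d j (λ i a b → pos i a (ℕₚ.m≤n⇒m≤1+n b))) (pos (suc j) (s≤s z≤n) ℕₚ.≤-refl)))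

sum-allSame : ∀ (F : ℕ → ℚ) P Q x n → (∀ c → F c ≡ (if c ≡ᵇ x then P else Q)) → n ≤ x →
  sumℚ (map F (upTo n)) ≡ ℕ→ℚ n *ℚ Q
sum-allSame F P Q x n F≡ n≤x =
  trans (cong sumℚ (Listₚ.map-cong-local (applyUpTo⁺₁ (λ k → k) n (λ {c} c<n →
          trans (F≡ c) (cong (λ b → if b then P else Q) (≢⇒≡ᵇ (ℕₚ.<⇒≢ (ℕₚ.<-≤-trans c<n n≤x))))))))
        (trans (sumℚ-const Q (upTo n)) (cong (λ z → ℕ→ℚ z *ℚ Q) (Listₚ.length-upTo n)))

sum-oneDifferent : ∀ (F : ℕ → ℚ) P Q x n → (∀ c → F c ≡ (if c ≡ᵇ x then P else Q)) → x < n →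
  sumℚ (map F (upTo n)) ≡ P +ℚ ℕ→ℚ (n ∸ 1) *ℚ Q
sum-oneDifferent F P Q x (suc n) F≡ x<n =
  trans (cong (λ l → sumℚ (map F l)) (sym (Listₚ.upTo-∷ʳ n)))
  (trans (cong sumℚ (Listₚ.map-++ F (upTo n) [ n ]))
  (trans (sumℚ-++ (map F (upTo n)) [ F n ])
  (trans (cong (sumℚ (map F (upTo n)) +ℚ_) (ℚₚ.+-identityʳ (F n))) lastSplit)))
  where
  lastSplit : sumℚ (map F (upTo n)) +ℚ F n ≡ P +ℚ ℕ→ℚ n *ℚ Q
  lastSplit with x ≟ n
  ... | yes refl rewrite sum-allSame F P Q x x F≡ ℕₚ.≤-refl | F≡ x | ≡ᵇ-refl x = ℚₚ.+-comm _ P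
  ... | no x≢n rewrite F≡ n | ≢⇒≡ᵇ (λ n≡x → x≢n (sym n≡x)) = earlier n (ℕₚ.≤∧≢⇒< (ℕₚ.≤-pred x<n) x≢n)
    where
    earlier : ∀ n → x < n → sumℚ (map F (upTo n)) +ℚ Q ≡ P +ℚ ℕ→ℚ n *ℚ Q
    earlier (suc k) x<k rewrite sum-oneDifferent F P Q x (suc k) F≡ x<k | ℕ→ℚ-suc k =
      solve 3 (λ P a Q → P :+ a :* Q :+ Q := P :+ (con 1ℚ :+ a) :* Q) refl P (ℕ→ℚ k) Q
      where open ℚ-Solver

-- For degrees d₁, d₂, ... along the path and an observable G:
--   Ω d q G is the right-hand side of the theorem with H replaced by G(·, 0);
--   Φ d j G is the value of expectAt when ℓ = ℓ₁, ..., ℓ_j = root and no ℓ_i with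
--   i ≥ 2 has a terminal child (the last term then carries G(·, 1)).

summand : (ℕ → ℕ) → (ℕ → ℕ → ℚ) → ℕ → ℚ
summand d G h = ℕ→ℚ (d (suc h) ∸ 1) *ℚ G (Σℕ 1 h d + 1 ∸ h) 0 *ℚ recip (Πℕ 2 (suc h) d)

Φ : (ℕ → ℕ) → ℕ → (ℕ → ℕ → ℚ) → ℚ
Φ d j G = Σℚ 1 (j ∸ 1) (summand d G) +ℚ G (Σℕ 1 j d ∸ j) 1 *ℚ recip (Πℕ 2 j d)

Ω : (ℕ → ℕ) → ℕ → (ℕ → ℕ → ℚ) → ℚ
Ω d q G = Σℚ 1 (q ∸ 2) (summand d G) +ℚ G (Σℕ 1 (q ∸ 1) d + 2 ∸ q) 0 *ℚ recip (Πℕ 2 (q ∸ 1) d)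

summand-cong : ∀ d d′ G j → (∀ i → i ≤ j → d i ≡ d′ i) → ∀ h → 1 ≤ h → h ≤ j ∸ 1 → summand d G h ≡ summand d′ G h
summand-cong d d′ G zero    eq (suc h) _ ()
summand-cong d d′ G (suc j) eq h _ h≤j =
  cong₂ _*ℚ_ (cong₂ (λ a b → ℕ→ℚ (a ∸ 1) *ℚ G (b + 1 ∸ h) 0) (eq (suc h) (s≤s h≤j))
                    (Σℕ-congR 1 h (λ i _ i≤h → eq i (ℕₚ.≤-trans i≤h (ℕₚ.m≤n⇒m≤1+n h≤j)))))
             (cong recip (Πℕ-congR 2 (suc h) (λ i _ i≤h → eq i (ℕₚ.≤-trans i≤h (s≤s h≤j)))))

Φ-cong : ∀ d d′ j G → (∀ i → i ≤ j → d i ≡ d′ i) → Φ d j G ≡ Φ d′ j G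
Φ-cong d d′ j G eq = cong₂ _+ℚ_ (Σℚ-congR 1 (j ∸ 1) (summand-cong d d′ G j eq))
  (cong₂ (λ u v → G (u ∸ j) 1 *ℚ recip v) (Σℕ-congR 1 j (λ i _ i≤j → eq i i≤j)) (Πℕ-congR 2 j (λ i _ i≤j → eq i i≤j)))

Ω-cong : ∀ d d′ q G → (∀ i → i ≤ q ∸ 1 → d i ≡ d′ i) → Ω d q G ≡ Ω d′ q G
Ω-cong d d′ q G eq = cong₂ _+ℚ_
  (Σℚ-congR 1 (q ∸ 2) (λ h 1≤h h≤ → summand-cong d d′ G (q ∸ 1) eq h 1≤h (ℕₚ.≤-trans h≤ (∸2≤∸1∸1 q))))
  (cong₂ (λ u v → G (u + 2 ∸ q) 0 *ℚ recip v) (Σℕ-congR 1 (q ∸ 1) (λ i _ i≤ → eq i i≤)) (Πℕ-congR 2 (q ∸ 1) (λ i _ i≤ → eq i i≤)))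
  where
  ∸2≤∸1∸1 : ∀ q → q ∸ 2 ≤ q ∸ 1 ∸ 1
  ∸2≤∸1∸1 zero          = z≤n
  ∸2≤∸1∸1 (suc zero)    = z≤n
  ∸2≤∸1∸1 (suc (suc q)) = ℕₚ.≤-refl

-- the shift of the witness count when a level with degree n is appended
∸-+-suc : ∀ S j n → j ≤ S → 1 ≤ n → (S + n) ∸ suc j ≡ (S ∸ j) + (n ∸ 1)
∸-+-suc S       zero    (suc n) _         _   = cong (_∸ 1) (ℕₚ.+-suc S n)
∸-+-suc (suc S) (suc j) n       (s≤s j≤S) 1≤n = ∸-+-suc S j n j≤S 1≤n

viaChoice-0 : ∀ G n x c v → viaChoice G n x c v 0 ≡ G v 0
viaChoice-0 G n x c v = cong₂ G (ℕₚ.+-identityʳ v) (ℕₚ.*-zeroʳ (𝟙 (c ≡ᵇ x)))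

-- Ω only evaluates observables at z = 0
Ω-viaChoice : ∀ d q G n x c → Ω d q (viaChoice G n x c) ≡ Ω d q G
Ω-viaChoice d q G n x c = cong₂ _+ℚ_
  (Σℚ-cong 1 (q ∸ 2) (λ h → cong (λ z → ℕ→ℚ (d (suc h) ∸ 1) *ℚ z *ℚ recip (Πℕ 2 (suc h) d)) (viaChoice-0 G n x c _)))
  (cong (_*ℚ recip (Πℕ 2 (q ∸ 1) d)) (viaChoice-0 G n x c _))

Φ-root : ∀ d G n → d 1 ≡ n → G (n ∸ 1) 1 ≡ Φ d 1 G
Φ-root d G n d₁≡n = sym (trans (ℚₚ.+-identityˡ _) (trans (ℚₚ.*-identityʳ _)
  (cong (λ z → G (z ∸ 1) 1) (trans (ℕₚ.+-identityʳ (d 1)) d₁≡n))))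

-- once the parent marks a terminal child (so never the child x), Φ becomes Ω
Φ-to-Ω : ∀ d j G → j ≤ Σℕ 1 j d → Φ d j (λ v z → G (v + z * 1) 0) ≡ Ω d (suc j) G
Φ-to-Ω d j G j≤Σ = cong₂ _+ℚ_
  (Σℚ-cong 1 (j ∸ 1) (λ h → cong (λ z → ℕ→ℚ (d (suc h) ∸ 1) *ℚ G z 0 *ℚ recip (Πℕ 2 (suc h) d)) (ℕₚ.+-identityʳ _)))
  (cong (λ z → G z 0 *ℚ recip (Πℕ 2 j d)) (sym (∸-+-suc (Σℕ 1 j d) j 2 j≤Σ (s≤s z≤n))))

-- Averaging Φ over the n uniform choices of a parent without terminal
-- children: choice x (probability 1/n) keeps the fully marked terminal and
-- adds n-1 witnesses, any other choice closes the summand for level j+1.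
Φ-step : ∀ d j n x G → 1 ≤ j → x < n → d (suc j) ≡ n → j ≤ Σℕ 1 j d →
  sumℚ (map (λ c → recip n *ℚ Φ d j (viaChoice G n x c)) (upTo n)) ≡ Φ d (suc j) G
Φ-step d (suc j₀) (suc n₀) x G _ x<n dₙ j≤Σ = begin
    sumℚ (map (λ c → r *ℚ Φ d j (viaChoice G n x c)) (upTo n))
  ≡⟨ sum-oneDifferent _ (r *ℚ (S +ℚ X₁ *ℚ ρ)) (r *ℚ (S +ℚ X₀ *ℚ ρ)) x n perChoice x<n ⟩
    r *ℚ (S +ℚ X₁ *ℚ ρ) +ℚ a *ℚ (r *ℚ (S +ℚ X₀ *ℚ ρ))
  ≡⟨ solve 6 (λ r a S X₀ X₁ ρ → r :* (S :+ X₁ :* ρ) :+ a :* (r :* (S :+ X₀ :* ρ))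
                              := (r :* (con 1ℚ :+ a)) :* S :+ a :* X₀ :* (ρ :* r) :+ X₁ :* (ρ :* r)) refl r a S X₀ X₁ ρ ⟩
    (r *ℚ (1ℚ +ℚ a)) *ℚ S +ℚ a *ℚ X₀ *ℚ (ρ *ℚ r) +ℚ X₁ *ℚ (ρ *ℚ r)
  ≡⟨ cong (λ z → z *ℚ S +ℚ a *ℚ X₀ *ℚ (ρ *ℚ r) +ℚ X₁ *ℚ (ρ *ℚ r)) r[1+a]≡1 ⟩
    1ℚ *ℚ S +ℚ a *ℚ X₀ *ℚ (ρ *ℚ r) +ℚ X₁ *ℚ (ρ *ℚ r)
  ≡⟨ cong (λ z → z +ℚ a *ℚ X₀ *ℚ (ρ *ℚ r) +ℚ X₁ *ℚ (ρ *ℚ r)) (ℚₚ.*-identityˡ S) ⟩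
    S +ℚ a *ℚ X₀ *ℚ (ρ *ℚ r) +ℚ X₁ *ℚ (ρ *ℚ r)
  ≡⟨ cong₂ (λ u v → S +ℚ u +ℚ v) (sym newSummand) (sym lastTerm) ⟩
    S +ℚ summand d G j +ℚ G (Σℕ 1 (suc j) d ∸ suc j) 1 *ℚ recip (Πℕ 2 (suc j) d)
  ≡⟨ cong (_+ℚ G (Σℕ 1 (suc j) d ∸ suc j) 1 *ℚ recip (Πℕ 2 (suc j) d)) (sym (Σℚ-snoc 1 j₀ (summand d G) (s≤s z≤n))) ⟩
    Φ d (suc j) G
  ∎
  where
  open ℚ-Solver
  j  = suc j₀
  n  = suc n₀
  r  = recip n
  a  = ℕ→ℚ (n ∸ 1)
  S  = Σℚ 1 (j ∸ 1) (summand d G)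
  ρ  = recip (Πℕ 2 j d)
  A  = Σℕ 1 j d ∸ j
  X₁ = G (A + (n ∸ 1)) 1
  X₀ = G (A + 1) 0
  r[1+a]≡1 : r *ℚ (1ℚ +ℚ a) ≡ 1ℚ
  r[1+a]≡1 = trans (cong (r *ℚ_) (sym (ℕ→ℚ-suc n₀))) (trans (ℚₚ.*-comm r _) (ℕ→ℚ*recip n₀))
  recip-Π : recip (Πℕ 2 (suc j) d) ≡ ρ *ℚ r
  recip-Π = trans (cong recip (trans (Πℕ-snoc 2 j d (s≤s (s≤s z≤n))) (cong (Πℕ 2 j d *_) dₙ))) (recip-* (Πℕ 2 j d) n)
  perChoice : ∀ c → r *ℚ Φ d j (viaChoice G n x c) ≡ (if c ≡ᵇ x then r *ℚ (S +ℚ X₁ *ℚ ρ) else r *ℚ (S +ℚ X₀ *ℚ ρ))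
  perChoice c = trans (cong (λ z → r *ℚ (z +ℚ viaChoice G n x c A 1 *ℚ ρ))
                            (Σℚ-cong 1 (j ∸ 1) (λ h → cong (λ z → ℕ→ℚ (d (suc h) ∸ 1) *ℚ z *ℚ recip (Πℕ 2 (suc h) d))
                                                             (viaChoice-0 G n x c _))))
                      byChoice
    where
    byChoice : r *ℚ (S +ℚ G (A + 1 * branchFactor n c x) (𝟙 (c ≡ᵇ x) * 1) *ℚ ρ)
               ≡ (if c ≡ᵇ x then r *ℚ (S +ℚ X₁ *ℚ ρ) else r *ℚ (S +ℚ X₀ *ℚ ρ))
    byChoice with c ≡ᵇ x
    ... | true  = cong (λ z → r *ℚ (S +ℚ G (A + z) 1 *ℚ ρ)) (ℕₚ.+-identityʳ (n ∸ 1))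
    ... | false = refl
  newSummand : summand d G j ≡ a *ℚ X₀ *ℚ (ρ *ℚ r)
  newSummand = trans (cong₂ (λ u v → ℕ→ℚ (u ∸ 1) *ℚ G v 0 *ℚ recip (Πℕ 2 (suc j) d)) dₙ (ℕₚ.+-∸-comm 1 j≤Σ))
                     (cong (λ z → a *ℚ X₀ *ℚ z) recip-Π)
  lastTerm : G (Σℕ 1 (suc j) d ∸ suc j) 1 *ℚ recip (Πℕ 2 (suc j) d) ≡ X₁ *ℚ (ρ *ℚ r)
  lastTerm = cong₂ (λ u v → G u 1 *ℚ v)
    (trans (cong (_∸ suc j) (trans (Σℕ-snoc 1 j d (s≤s z≤n)) (cong (Σℕ 1 j d +_) dₙ))) (∸-+-suc (Σℕ 1 j d) j n j≤Σ (s≤s z≤n)))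
    recip-Π

anc-cons : ∀ x p i → i ≤ suc (length p) → anc (x ∷ p) i ≡ x ∷ anc p i
anc-cons x p i i≤ = cong (λ z → take z (x ∷ p)) (ℕₚ.+-∸-assoc 1 (pred-≤ i i≤))
  where
  pred-≤ : ∀ i → i ≤ suc (length p) → i ∸ 1 ≤ length p
  pred-≤ zero    _         = z≤n
  pred-≤ (suc i) (s≤s i≤) = i≤

anc-root : ∀ p i → suc (length p) ≤ i → anc p i ≡ []
anc-root p (suc i) (s≤s p≤i) = cong (λ z → take z p) (ℕₚ.m≤n⇒m∸n≡0 p≤i)

dAt-anc-cons : ∀ ts x t p → lookupL ts x ≡ just t → ∀ i → i ≤ suc (length p) →
  dAt (stein ts) (anc (x ∷ p) i) ≡ dAt t (anc p i)
dAt-anc-cons ts x t p lt i i≤ rewrite anc-cons x p i i≤ | lt = refl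

tAt-anc-cons : ∀ ts x t p → lookupL ts x ≡ just t → ∀ i → i ≤ suc (length p) →
  tAt (stein ts) (anc (x ∷ p) i) ≡ tAt t (anc p i)
tAt-anc-cons ts x t p lt i i≤ rewrite anc-cons x p i i≤ | lt = refl

steiner-root : ∀ s p → IsSteinerAt s p → Σ (List Tree) λ ts → s ≡ stein ts
steiner-root term       []      (_ , ())
steiner-root term       (x ∷ p) (_ , ())
steiner-root (stein ts) p       _ = ts , refl

steiner-child : ∀ ts x p → IsSteinerAt (stein ts) (x ∷ p) → Σ Tree λ t → (lookupL ts x ≡ just t) × IsSteinerAt t p
steiner-child ts x p ist with lookupL ts x | ist
... | just t  | (us , eq) = t , refl , us , eq
... | nothing | (us , ())

wf-child : ∀ ts x t → WF (stein ts) → lookupL ts x ≡ just t → WF t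
wf-child ts x t (wf-stein _ _ wfs) = go ts x wfs
  where
  go : ∀ ts x → All WF ts → lookupL ts x ≡ just t → WF t
  go (t′ ∷ ts) zero    (wf ∷ _)   refl = wf
  go (t′ ∷ ts) (suc x) (_ ∷ wfs) eq   = go ts x wfs eq

wf-degree : ∀ {ts} → WF (stein ts) → 1 ≤ length ts
wf-degree (wf-stein 1≤n _ _) = 1≤n

degree-positive : ∀ s p → WF s → IsSteinerAt s p → ∀ i → 1 ≤ i → i ≤ suc (length p) → 1 ≤ dAt s (anc p i)
degree-positive s [] wf ist (suc zero) _ _ with steiner-root s [] ist
... | ts , refl = wf-degree wf
degree-positive s [] wf ist (suc (suc i)) _ (s≤s ())
degree-positive s (x ∷ p) wf ist i 1≤i i≤ with steiner-root s (x ∷ p) ist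
... | ts , refl with steiner-child ts x p ist
...   | t , lt , ist′ with i ≤? suc (length p)
...     | yes i≤′ rewrite dAt-anc-cons ts x t p lt i i≤′ = degree-positive t p (wf-child ts x t wf lt) ist′ i 1≤i i≤′
...     | no  i≰  rewrite anc-root (x ∷ p) i (ℕₚ.≰⇒> i≰) = wf-degree wf

termIdx-none : ∀ k ts → tcount ts ≡ 0 → termIdx k ts ≡ []
termIdx-none k []             _   = refl
termIdx-none k (stein _ ∷ ts) t≡0 = termIdx-none (suc k) ts t≡0

termIdx-some : ∀ k ts → 1 ≤ tcount ts → Σ ℕ λ c → Σ (List ℕ) λ cs → termIdx k ts ≡ c ∷ cs
termIdx-some k (term ∷ ts)    _   = k , termIdx (suc k) ts , refl
termIdx-some k (stein _ ∷ ts) 1≤t = termIdx-some (suc k) ts 1≤t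

allowed-noTerminal : ∀ ts → tcount ts ≡ 0 → 1 ≤ length ts → allowed ts ≡ upTo (length ts)
allowed-noTerminal ts t≡0 1≤n rewrite allowed≡ ts | termIdx-none 0 ts t≡0 = allChildren≡ (length ts) 1≤n

allowed-terminal : ∀ ts → 1 ≤ tcount ts → allowed ts ≡ termIdx 0 ts
allowed-terminal ts 1≤t rewrite allowed≡ ts with termIdx-some 0 ts 1≤t
... | c , cs , eq rewrite eq = refl

expectAt-noTerminal : ∀ s p → WF s → IsSteinerAt s p →
  (∀ i → 2 ≤ i → i ≤ suc (length p) → tAt s (anc p i) ≡ 0) →
  ∀ G → expectAt s p G ≡ Φ (λ i → dAt s (anc p i)) (suc (length p)) G
expectAt-noTerminal s [] wf ist _ G with steiner-root s [] ist
... | ts , refl = trans (expectAt-root ts G wf) (Φ-root (λ i → dAt (stein ts) (anc [] i)) G (length ts) refl)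
expectAt-noTerminal s (x ∷ p) wf ist none G with steiner-root s (x ∷ p) ist
... | ts , refl with steiner-child ts x p ist
...   | t , lt , ist′ = begin
    expectAt (stein ts) (x ∷ p) G
  ≡⟨ expectAt-child ts x t p G wf lt ⟩
    sumℚ (map (λ c → recip (length (allowed ts)) *ℚ expectAt t p (viaChoice G n x c)) (allowed ts))
  ≡⟨ cong (λ cs → sumℚ (map (λ c → recip (length cs) *ℚ expectAt t p (viaChoice G n x c)) cs))
          (allowed-noTerminal ts rootNone (wf-degree wf)) ⟩
    sumℚ (map (λ c → recip (length (upTo n)) *ℚ expectAt t p (viaChoice G n x c)) (upTo n))
  ≡⟨ cong (λ k → sumℚ (map (λ c → recip k *ℚ expectAt t p (viaChoice G n x c)) (upTo n))) (Listₚ.length-upTo n) ⟩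
    sumℚ (map (λ c → recip n *ℚ expectAt t p (viaChoice G n x c)) (upTo n))
  ≡⟨ cong sumℚ (Listₚ.map-cong (λ c → cong (recip n *ℚ_) (trans (expectAt-noTerminal t p wft ist′ none′ (viaChoice G n x c))
                                                               (Φ-cong d′ d j (viaChoice G n x c) (λ i i≤ → sym (dAt-anc-cons ts x t p lt i i≤)))))
                               (upTo n)) ⟩
    sumℚ (map (λ c → recip n *ℚ Φ d j (viaChoice G n x c)) (upTo n))
  ≡⟨ Φ-step d j n x G (s≤s z≤n) (lookup-bound ts x lt) dₙ
            (Σℕ-≥ d j (λ i 1≤i i≤j → degree-positive (stein ts) (x ∷ p) wf ist i 1≤i (ℕₚ.m≤n⇒m≤1+n i≤j))) ⟩
    Φ d (suc j) G
  ∎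
  where
  n   = length ts
  j   = suc (length p)
  d   = λ i → dAt (stein ts) (anc (x ∷ p) i)
  d′  = λ i → dAt t (anc p i)
  wft = wf-child ts x t wf lt
  rootNone : tcount ts ≡ 0
  rootNone = subst (λ z → tAt (stein ts) z ≡ 0) (anc-root (x ∷ p) (suc j) ℕₚ.≤-refl) (none (suc j) (s≤s (s≤s z≤n)) ℕₚ.≤-refl)
  none′ : ∀ i → 2 ≤ i → i ≤ suc (length p) → tAt t (anc p i) ≡ 0
  none′ i 2≤i i≤ = trans (sym (tAt-anc-cons ts x t p lt i i≤)) (none i 2≤i (ℕₚ.m≤n⇒m≤1+n i≤))
  dₙ : d (suc j) ≡ n
  dₙ = cong (dAt (stein ts)) (anc-root (x ∷ p) (suc j) ℕₚ.≤-refl)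

-- The case that ℓ_q is the root: the root marks one of its terminal children,
-- never the child x towards ℓ, and below x no ℓ_i has a terminal child, so
-- expectAt-noTerminal applies inside the subtree of x.
expectAt-terminalRoot : ∀ ts x t p G → WF (stein ts) → lookupL ts x ≡ just t → IsSteinerAt t p → 1 ≤ tcount ts →
  (∀ i → 2 ≤ i → i ≤ suc (length p) → tAt t (anc p i) ≡ 0) →
  expectAt (stein ts) (x ∷ p) G ≡ Ω (λ i → dAt t (anc p i)) (suc (suc (length p))) G
expectAt-terminalRoot ts x t p G wf lt ist rootSome none with allowed-nonempty ts (wf-degree wf)
... | k , len = trans (expectAt-child ts x t p G wf lt)
  (trans (cong sumℚ (Listₚ.map-cong-local
            (subst (All (λ c → recip (length (allowed ts)) *ℚ expectAt t p (viaChoice G n x c) ≡ recip (length (allowed ts)) *ℚ V))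
                   (sym (allowed-terminal ts rootSome))
                   (All-map (λ {c} isTerm → cong (recip (length (allowed ts)) *ℚ_) (perTerminal c isTerm)) (termIdx-terminal ts)))))
         (average-const (allowed ts) k len V))
  where
  n   = length ts
  d   = λ i → dAt t (anc p i)
  V   = Ω d (suc (suc (length p))) G
  wft = wf-child ts x t wf lt
  notTowardsℓ : ∀ c → lookupL ts c ≡ just term → (c ≡ᵇ x) ≡ false
  notTowardsℓ c isTerm = ≢⇒≡ᵇ c≢x
    where
    c≢x : c ≢ x
    c≢x refl with steiner-root t p ist
    ... | _ , refl with trans (sym isTerm) lt
    ...   | ()
  perTerminal : ∀ c → lookupL ts c ≡ just term → expectAt t p (viaChoice G n x c) ≡ V
  perTerminal c isTerm =
    trans (cong (λ b → expectAt t p (λ v z → G (v + z * (if b then n ∸ 1 else 1)) (𝟙 b * z))) (notTowardsℓ c isTerm))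
      (trans (expectAt-noTerminal t p wft ist none (λ v z → G (v + z * 1) 0))
             (Φ-to-Ω d (suc (length p)) G (Σℕ-≥ d (suc (length p)) (degree-positive t p wft ist))))

-- While ℓ_q lies strictly below the
-- root, the value in the child subtree does not depend on the root's choice;
-- when ℓ_q is the root, expectAt-terminalRoot applies.
expectAt-closedForm : ∀ s p q → WF s → IsSteinerAt s p → 2 ≤ q → q ≤ suc (length p) → 1 ≤ tAt s (anc p q) →
  (∀ i → 2 ≤ i → i < q → tAt s (anc p i) ≡ 0) → ∀ G → expectAt s p G ≡ Ω (λ i → dAt s (anc p i)) q G
expectAt-closedForm s [] q wf ist (s≤s (s≤s _)) (s≤s ()) _ _ _
expectAt-closedForm s (x ∷ p) q wf ist 2≤q q≤ some none G with steiner-root s (x ∷ p) ist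
... | ts , refl with steiner-child ts x p ist | allowed-nonempty ts (wf-degree wf)
...   | t , lt , ist′ | k , len with q ≤? suc (length p)
...     | yes q≤′ = trans (expectAt-child ts x t p G wf lt)
            (trans (cong sumℚ (Listₚ.map-cong (λ c → cong (recip (length (allowed ts)) *ℚ_) (perChoice c)) (allowed ts)))
                   (average-const (allowed ts) k len (Ω d q G)))
  where
  d  = λ i → dAt (stein ts) (anc (x ∷ p) i)
  d′ = λ i → dAt t (anc p i)
  some′ : 1 ≤ tAt t (anc p q)
  some′ = subst (1 ≤_) (tAt-anc-cons ts x t p lt q q≤′) some
  none′ : ∀ i → 2 ≤ i → i < q → tAt t (anc p i) ≡ 0
  none′ i 2≤i i<q = trans (sym (tAt-anc-cons ts x t p lt i (ℕₚ.≤-trans (ℕₚ.<⇒≤ i<q) q≤′))) (none i 2≤i i<q)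
  perChoice : ∀ c → expectAt t p (viaChoice G (length ts) x c) ≡ Ω d q G
  perChoice c = trans (expectAt-closedForm t p q (wf-child ts x t wf lt) ist′ 2≤q q≤′ some′ none′ (viaChoice G (length ts) x c))
    (trans (Ω-viaChoice d′ q G (length ts) x c)
           (Ω-cong d′ d q G (λ i i≤ → sym (dAt-anc-cons ts x t p lt i (ℕₚ.≤-trans i≤ (ℕₚ.≤-trans (ℕₚ.m∸n≤m q 1) q≤′))))))
...     | no q≰ with ℕₚ.≤-antisym q≤ (ℕₚ.≰⇒> q≰)
...       | refl = trans (expectAt-terminalRoot ts x t p G wf lt ist′ rootSome none′)
                         (Ω-cong _ _ (suc (suc (length p))) G (λ i i≤ → sym (dAt-anc-cons ts x t p lt i i≤)))
  where
  rootSome : 1 ≤ tcount ts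
  rootSome = subst (λ z → 1 ≤ tAt (stein ts) z) (anc-root (x ∷ p) (suc (suc (length p))) ℕₚ.≤-refl) some
  none′ : ∀ i → 2 ≤ i → i ≤ suc (length p) → tAt t (anc p i) ≡ 0
  none′ i 2≤i i≤ = trans (sym (tAt-anc-cons ts x t p lt i i≤)) (none i 2≤i (s≤s i≤))

lemma5 : (T : Tree) → Admissible T →
    (p : List ℕ) → p ≢ [] → IsSteinerAt T p →
    (q : ℕ) → 2 ≤ q → q ≤ length p + 1 →
    1 ≤ tAt T (anc p q) →
    (∀ i → 2 ≤ i → i < q → tAt T (anc p i) ≡ 0) →
    cost T p ≡ formula (λ i → dAt T (anc p i)) q
lemma5 (stein ts) (wf , _) p _ ist q 2≤q q≤ some none =
  expectAt-closedForm (stein ts) p q wf ist 2≤q (subst (q ≤_) (ℕₚ.+-comm (length p) 1) q≤) some none (λ v _ → H v)
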